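{- Let $R$ be a consistent set of rooted triples that identifies a phylogenetic tree $T$. Suppose $T_1$ and $T_2$ are phylogenetic trees on $L_R$ that display all triples of $R$, where $T_1$ has the minimum number of vertices among all phylogenetic trees on $L_R$ displaying $R$, and $T_2$ minimizes $|\mathfrak{R}(T_2)|$ among all phylogenetic trees on $L_R$ displaying $R$. Then $T\simeq \mathrm{Aho}(R)\simeq T_1\simeq T_2$ (isomorphism of leaf-labeled rooted trees).
   Context: A phylogenetic tree on a finite set $L$ is a rooted tree with leaf set $L$ and no inner vertex of outdegree one. For a vertex $v$, $L(v)$ is the set of leaves below (or equal to) $v$, and $\mathcal{C}(T)=\{L(v): v\in V(T)\}$. A phylogenetic tree $S$ refines $T$ if $\mathcal{C}(T)\subseteq\mathcal{C}(S)$. A rooted triple $(xy|z)$ on distinct leaves with leaf set $L_r=\{x,y,z\}$ is displayed by $T$ if $\operatorname{lca}_T(x,y)$ is a proper descendant of $\operatorname{lca}_T(x,y,z)$; $\mathfrak{R}(T)$ is the set of triples displayed by $T$. For a triple set $R$, $L_R=\bigcup_{r\in R}L_r$, and $R$ is consistent if some phylogenetic tree on $L_R$ displays $R$. $R$ identifies $T$ if $T$ displays $R$ and every other phylogenetic tree displaying $R$ is a refinement of $T$. For $S\subseteq L_R$, the Aho graph $[R,S]$ has vertex set $S$, with $x,y$ adjacent iff some $(xy|z)\in R$ has $z\in S$. BUILD$(R,S)$ returns a single vertex if $|S|=1$; otherwise, if $[R,S]$ is disconnected, it returns a root whose children are the roots of BUILD$(R,C)$ for the vertex sets $C$ of the connected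 components of $[R,S]$ (and it fails if $[R,S]$ is connected). $\mathrm{Aho}(R)=$ BUILD$(R,L_R)$. -}

module Defs where

open import Data.Nat using (ℕ; zero; suc; _≤_; _≟_; _≡ᵇ_; _<ᵇ_; _≤ᵇ_)
open import Data.Bool using (Bool; true; false; _∧_; _∨_; not; if_then_else_; T)
open import Data.List using (List; []; _∷_; _++_; length; concatMap; map; filter; deduplicate)
open import Data.Bool.ListAction using (all; any)
open import Data.Nat.ListAction using (sum)
open import Data.List.Membership.Propositional using (_∈_)
open import Data.List.Relation.Unary.All using (All)
open import Data.List.Relation.Unary.Any using (Any)
open import Data.List.Relation.Unary.Unique.Propositional using (Unique)
open import Data.List.Relation.Binary.Permutation.Propositional using (_↭_)
open import Data.List.Relation.Binary.Pointwise using (Pointwise)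
import Data.List.Membership.DecPropositional as DecMem
open import Data.Maybe using (Maybe; just; nothing)
open import Data.Product using (_×_; ∃-syntax; _,_)
open import Data.Unit using (⊤)
open import Relation.Nullary using (does)
open import Relation.Nullary.Decidable using (T?)
open import Relation.Binary.PropositionalEquality using (_≡_; _≢_)

elemB : ℕ → List ℕ → Bool
elemB x xs = does (DecMem._∈?_ _≟_ x xs)

-- Rooted trees with leaves labelled by natural numbers.
-- A vertex is either a leaf carrying a label, or an inner vertex with
-- an (ordered, but order is irrelevant up to ≅) list of children.

data Tree : Set where
  leaf : ℕ → Tree
  node : List Tree → Tree

mutual
  leaves : Tree → List ℕ
  leaves (leaf x)  = x ∷ []
  leaves (node ts) = leavesL ts

  leavesL : List Tree → List ℕ
  leavesL []       = []
  leavesL (t ∷ ts) = leaves t ++ leavesL ts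

mutual
  size : Tree → ℕ
  size (leaf x)  = 1
  size (node ts) = suc (sizeL ts)

  sizeL : List Tree → ℕ
  sizeL []       = 0
  sizeL (t ∷ ts) = size t Data.Nat.+ sizeL ts

mutual
  clusters : Tree → List (List ℕ)
  clusters (leaf x)  = (x ∷ []) ∷ []
  clusters (node ts) = leavesL ts ∷ clustersL ts

  clustersL : List Tree → List (List ℕ)
  clustersL []       = []
  clustersL (t ∷ ts) = clusters t ++ clustersL ts

mutual
  Branched : Tree → Set
  Branched (leaf x)  = ⊤
  Branched (node ts) = (2 ≤ length ts) × BranchedL ts

  BranchedL : List Tree → Set
  BranchedL []       = ⊤
  BranchedL (t ∷ ts) = Branched t × BranchedL ts

Phylo : Tree → Set
Phylo t = Branched t × Unique (leaves t)

OnLeaves : Tree → List ℕ → Set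
OnLeaves t L = ∀ x → (x ∈ leaves t → x ∈ L) × (x ∈ L → x ∈ leaves t)

SameSet : List ℕ → List ℕ → Set
SameSet A B = ∀ x → (x ∈ A → x ∈ B) × (x ∈ B → x ∈ A)

Refines : Tree → Tree → Set
Refines s t = All (λ c → Any (SameSet c) (clusters s)) (clusters t)

data _≅_ : Tree → Tree → Set where
  leaf≅ : ∀ {x} → leaf x ≅ leaf x
  node≅ : ∀ {ts us vs} → ts ↭ vs → Pointwise _≅_ vs us → node ts ≅ node us

-- Least common ancestors, as the path (list of child indices) from the
-- root.  lca of a set X: descend into the child whose leaf set contains
-- all of X, as long as there is one.

mutual
  lcaPath : List ℕ → Tree → List ℕ
  lcaPath X (leaf x)  = []
  lcaPath X (node ts) = lcaPathL 0 X ts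

  lcaPathL : ℕ → List ℕ → List Tree → List ℕ
  lcaPathL i X []       = []
  lcaPathL i X (t ∷ ts) =
    if all (λ x → elemB x (leaves t)) X
    then i ∷ lcaPath X t
    else lcaPathL (suc i) X ts

-- p is a proper prefix of q, i.e. the vertex q is a proper descendant of p
properPrefix : List ℕ → List ℕ → Bool
properPrefix []      []      = false
properPrefix []      (_ ∷ _) = true
properPrefix (_ ∷ _) []      = false
properPrefix (a ∷ p) (b ∷ q) = (a ≡ᵇ b) ∧ properPrefix p q

-- triple x y z stands for (xy|z)
record Triple : Set where
  constructor triple
  field
    tx ty tz : ℕ
open Triple public

ValidTriple : Triple → Set
ValidTriple r = (tx r ≢ ty r) × (tx r ≢ tz r) × (ty r ≢ tz r)

displaysB : Tree → ℕ → ℕ → ℕ → Bool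
displaysB t x y z =
  elemB x (leaves t) ∧ elemB y (leaves t) ∧ elemB z (leaves t) ∧
  properPrefix (lcaPath (x ∷ y ∷ z ∷ []) t) (lcaPath (x ∷ y ∷ []) t)

Displays : Tree → Triple → Set
Displays t r = T (displaysB t (tx r) (ty r) (tz r))

-- |𝔑(T)|: number of triples (xy|z) (with (xy|z) = (yx|z)) displayed by t
tripleCount : Tree → ℕ
tripleCount t =
  sum (concatMap (λ x → concatMap (λ y → map (λ z → f x y z) L) L) L)
  where
    L = leaves t
    f : ℕ → ℕ → ℕ → ℕ
    f x y z = if (x <ᵇ y) ∧ not (z ≡ᵇ x) ∧ not (z ≡ᵇ y) ∧ displaysB t x y z
              then 1 else 0

LR : List Triple → List ℕ
LR R = deduplicate _≟_ (concatMap (λ r → tx r ∷ ty r ∷ tz r ∷ []) R)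

Consistent : List Triple → Set
Consistent R = ∃[ t ] (Phylo t × OnLeaves t (LR R) × All (Displays t) R)

Identifies : List Triple → Tree → Set
Identifies R t =
  Phylo t × All (Displays t) R ×
  (∀ s → Phylo s → OnLeaves s (LR R) → All (Displays s) R → Refines s t)

ahoEdge : List Triple → List ℕ → ℕ → ℕ → Bool
ahoEdge R S a b =
  any (λ r → (((tx r ≡ᵇ a) ∧ (ty r ≡ᵇ b)) ∨ ((tx r ≡ᵇ b) ∧ (ty r ≡ᵇ a)))
             ∧ elemB (tz r) S) R

grow : List Triple → List ℕ → List ℕ → List ℕ
grow R S C =
  C ++ filter (λ u → T? (not (elemB u C) ∧ any (λ w → ahoEdge R S w u) C)) S

iterGrow : ℕ → List Triple → List ℕ → List ℕ → List ℕ
iterGrow zero    R S C = C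
iterGrow (suc n) R S C = iterGrow n R S (grow R S C)

component : List Triple → List ℕ → ℕ → List ℕ
component R S v = iterGrow (length S) R S (v ∷ [])

components : ℕ → List Triple → List ℕ → List ℕ → List (List ℕ)
components zero    R S rest       = []
components (suc n) R S []         = []
components (suc n) R S (v ∷ rest) =
  let C = component R S v in
  C ∷ components n R S (filter (λ u → T? (not (elemB u C))) rest)

mutual
  -- BUILD(R,S) with fuel; nothing = failure
  build : ℕ → List Triple → List ℕ → Maybe Tree
  build zero    R S                = nothing
  build (suc n) R []               = nothing
  build (suc n) R (x ∷ [])         = just (leaf x)
  build (suc n) R (x ∷ y ∷ rest)   =
    let S  = x ∷ y ∷ rest
        cs = components (length S) R S S
    in if length cs ≤ᵇ 1 then nothing else buildNode (buildL n R cs)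

  buildNode : Maybe (List Tree) → Maybe Tree
  buildNode (just ts) = just (node ts)
  buildNode nothing   = nothing

  buildL : ℕ → List Triple → List (List ℕ) → Maybe (List Tree)
  buildL n R []       = just []
  buildL n R (C ∷ Cs) = cons (build n R C) (buildL n R Cs)

  cons : Maybe Tree → Maybe (List Tree) → Maybe (List Tree)
  cons (just t) (just ts) = just (t ∷ ts)
  cons _        _         = nothing

-- Aho(R) = BUILD(R, L_R); the fuel |L_R|+1 bounds the recursion depth
aho : List Triple → Maybe Tree
aho R = build (suc (length (LR R))) R (LR R)

module Submission where

-- A phylogenetic tree is determined up to isomorphism by its cluster system C(T), and it displays
-- (xy|z) exactly when some cluster contains x and y but not z.  As R identifies T, every tree on L_R
-- displaying R has all clusters of T.  Since T separates every triple of R, the leaves below a child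
-- of a vertex of T form a union of components of the Aho graph, so every Aho graph met by BUILD is
-- disconnected and Aho(R) exists; as C(T) ⊆ C(Aho(R)), the same closure argument matches the children
-- of each vertex of Aho(R) with those of T, whence C(Aho(R)) = C(T).  For T₁, C(T) ⊆ C(T₁) and
-- |V(T₁)| ≤ |V(T)| = |C(T)| force C(T₁) = C(T).  For T₂, every triple displayed by T stays displayed,
-- and a cluster K of T₂ outside C(T) contains leaves x, y with some leaf z ∉ K such that T does not
-- display (xy|z); so T₂ displays strictly more triples than T, contradicting the minimality of |𝔑(T₂)|.

open import Defs
open import Data.Nat using (ℕ; zero; suc; _≤_; _<_; _≟_; z≤n; s≤s; _+_; _≡ᵇ_; _<ᵇ_; _≤ᵇ_)
open import Data.Bool using (Bool; true; false; T; not; _∧_; _∨_; if_then_else_)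
open import Data.Unit using (tt)
open import Data.Bool.Properties using (T-≡; T-not-≡; T-∧; T-∨; ∨-comm)
open import Data.Bool.ListAction using (all; any)
open import Data.Nat.Properties
  using (+-suc; +-comm; 1+n≰n; ≤-reflexive; ≤-refl; ≤-trans; m≤m+n; +-monoʳ-≤; <-irrefl; <-≤-trans;
         +-mono-≤; +-mono-<-≤; +-mono-≤-<; <⇒<ᵇ; <⇒≱; <-cmp; ≡⇒≡ᵇ; ≡ᵇ⇒≡; module ≤-Reasoning)
open import Data.List using (List; []; _∷_; _++_; length; map; concatMap; filter)
open import Data.List.Properties using (length-++; map-cong; filter-none; ++-identityʳ; length-filter)
open import Data.Nat.ListAction using (sum)
open import Data.Nat.ListAction.Properties using (sum-++; sum-↭)
open import Data.List.Membership.Propositional using (_∈_; _∉_; find; lose)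
open import Data.List.Membership.Propositional.Properties
  using (∈-++⁺ˡ; ∈-++⁺ʳ; ∈-++⁻; ∈-∃++; ∈-filter⁺; ∈-filter⁻; ∈-concatMap⁺; ∈-concatMap⁻;
         ∈-deduplicate⁺; ∈-deduplicate⁻)
open import Data.List.Membership.Propositional.Properties.WithK using (unique∧set⇒bag)
import Data.List.Membership.DecPropositional as DecMembership
open import Data.List.Relation.Unary.All as All using (All; []; _∷_)
open import Data.List.Relation.Unary.Any using (here; there; any?)
open import Data.List.Relation.Unary.Any.Properties using (any⁺; any⁻)
open import Data.List.Relation.Unary.AllPairs using (AllPairs; []; _∷_)
import Data.List.Relation.Unary.AllPairs.Properties as AllPairs
open import Data.List.Relation.Unary.Unique.Propositional using (Unique)
open import Data.List.Relation.Unary.Unique.DecPropositional.Properties using (deduplicate-!)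
import Data.List.Relation.Unary.Unique.Propositional.Properties as Unique
open import Data.List.Relation.Binary.Subset.Propositional using (_⊆_)
open import Data.List.Relation.Binary.Disjoint.Propositional using (Disjoint)
open import Data.List.Relation.Binary.Permutation.Propositional using (_↭_; ↭-refl; ↭-trans; prep)
open import Data.List.Relation.Binary.Permutation.Propositional.Properties using (shift; map⁺; ↭-length)
open import Data.List.Relation.Binary.Pointwise using (Pointwise; []; _∷_; Pointwise-length)
import Data.List.Relation.Binary.Pointwise as Pointwise
open import Data.List.Relation.Binary.BagAndSetEquality using (∼bag⇒↭)
open import Data.Product using (_×_; _,_; proj₁; proj₂; ∃-syntax)
open import Data.Sum using (_⊎_; inj₁; inj₂)
open import Data.Empty using (⊥-elim)
open import Data.Maybe using (just; nothing)
open import Function.Base using (_∘_)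
open import Function.Bundles using (Equivalence; _⇔_; mk⇔)
open Equivalence using (to; from)
open import Function.Construct.Composition using (_⇔-∘_)
open import Function.Construct.Symmetry using (⇔-sym)
open import Relation.Nullary using (¬_; Dec; yes; no)
open import Relation.Binary.Definitions using (Tri; tri<; tri≈; tri>)
open import Relation.Nullary.Decidable using (dec-true; dec-false; T?)
open import Relation.Binary.PropositionalEquality using (_≡_; _≢_; refl; sym; trans; cong; cong₂; subst; subst₂)

module _ {x : ℕ} {xs : List ℕ} where

  ∈⇒elemB≡true : x ∈ xs → elemB x xs ≡ true
  ∈⇒elemB≡true = dec-true (DecMembership._∈?_ _≟_ x xs)

  ∉⇒elemB≡false : x ∉ xs → elemB x xs ≡ false
  ∉⇒elemB≡false = dec-false (DecMembership._∈?_ _≟_ x xs)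

  elemB≡true⇒∈ : elemB x xs ≡ true → x ∈ xs
  elemB≡true⇒∈ e with DecMembership._∈?_ _≟_ x xs | e
  ... | yes x∈xs | _ = x∈xs
  ... | no _ | ()

  elemB≡false⇒∉ : elemB x xs ≡ false → x ∉ xs
  elemB≡false⇒∉ e with DecMembership._∈?_ _≟_ x xs | e
  ... | no x∉xs | _ = x∉xs
  ... | yes _ | ()

T-elemB⇔∈ : ∀ {x xs} → T (elemB x xs) ⇔ x ∈ xs
T-elemB⇔∈ = mk⇔ (elemB≡true⇒∈ ∘ to T-≡) (from T-≡ ∘ ∈⇒elemB≡true)

SameSet-refl : ∀ {A} → SameSet A A
SameSet-refl x = (λ p → p) , (λ p → p)

SameSet-sym : ∀ {A B} → SameSet A B → SameSet B A
SameSet-sym s x = proj₂ (s x) , proj₁ (s x)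

SameSet-trans : ∀ {A B C} → SameSet A B → SameSet B C → SameSet A C
SameSet-trans s t x = (λ p → proj₁ (t x) (proj₁ (s x) p)) , (λ p → proj₂ (s x) (proj₂ (t x) p))

⊆-or-witness : ∀ (A B : List ℕ) → A ⊆ B ⊎ ∃[ x ] (x ∈ A × x ∉ B)
⊆-or-witness [] B = inj₁ (λ ())
⊆-or-witness (a ∷ A) B with DecMembership._∈?_ _≟_ a B | ⊆-or-witness A B
... | no a∉B | _                    = inj₂ (a , here refl , a∉B)
... | yes _  | inj₂ (x , x∈A , x∉B) = inj₂ (x , there x∈A , x∉B)
... | yes a∈B | inj₁ A⊆B            = inj₁ λ { (here refl) → a∈B ; (there p) → A⊆B p }

SameSet? : ∀ (A B : List ℕ) → Dec (SameSet A B)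
SameSet? A B with ⊆-or-witness A B | ⊆-or-witness B A
... | inj₁ A⊆B | inj₁ B⊆A            = yes λ x → A⊆B , B⊆A
... | inj₂ (x , x∈A , x∉B) | _        = no λ s → x∉B (proj₁ (s x) x∈A)
... | inj₁ _ | inj₂ (x , x∈B , x∉A)   = no λ s → x∉A (proj₂ (s x) x∈B)

find-SameSet : ∀ K Ks → (∃[ K′ ] (K′ ∈ Ks × SameSet K K′)) ⊎ (∀ {K′} → K′ ∈ Ks → ¬ SameSet K′ K)
find-SameSet K Ks with any? (SameSet? K) Ks
... | yes K∈Ks = inj₁ (find K∈Ks)
... | no K∉Ks = inj₂ λ K′∈Ks K′~K → K∉Ks (lose K′∈Ks (SameSet-sym K′~K))

Unique-++⁻ˡ : ∀ {xs ys : List ℕ} → Unique (xs ++ ys) → Unique xs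
Unique-++⁻ˡ {[]} u = []
Unique-++⁻ˡ {x ∷ xs} (x∉ ∷ u) = All.tabulate (λ q → All.lookup x∉ (∈-++⁺ˡ q)) ∷ Unique-++⁻ˡ u

Unique-++⁻ʳ : ∀ {xs ys : List ℕ} → Unique (xs ++ ys) → Unique ys
Unique-++⁻ʳ {[]} u = u
Unique-++⁻ʳ {x ∷ xs} (_ ∷ u) = Unique-++⁻ʳ {xs} u

Unique-++⇒Disjoint : ∀ {xs ys : List ℕ} → Unique (xs ++ ys) → Disjoint xs ys
Unique-++⇒Disjoint {x ∷ xs} (x∉ ∷ u) (here refl , q) = All.lookup x∉ (∈-++⁺ʳ xs q) refl
Unique-++⇒Disjoint {x ∷ xs} (_ ∷ u) (there p , q) = Unique-++⇒Disjoint u (p , q)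

Unique∧SameSet⇒↭ : ∀ {A B : List ℕ} → Unique A → Unique B → SameSet A B → A ↭ B
Unique∧SameSet⇒↭ uA uB s = ∼bag⇒↭ (unique∧set⇒bag uA uB (λ {x} → mk⇔ (proj₁ (s x)) (proj₂ (s x))))

module Pigeonhole {A : Set} (_~_ : A → A → Set)
  (~-refl : ∀ {a} → a ~ a) (~-sym : ∀ {a b} → a ~ b → b ~ a)
  (~-trans : ∀ {a b c} → a ~ b → b ~ c → a ~ c) where

  Distinct : List A → Set
  Distinct = AllPairs (λ a b → ¬ (a ~ b))

  _⋐_ : List A → List A → Set
  xs ⋐ ys = ∀ {a} → a ∈ xs → ∃[ b ] (b ∈ ys × a ~ b)

  length-mono : ∀ {xs ys} → Distinct xs → xs ⋐ ys → length xs ≤ length ys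
  length-mono {[]} _ _ = z≤n
  length-mono {a ∷ xs} {ys} (a≁xs ∷ d) f with f (here refl)
  ... | b , b∈ys , a~b with ∈-∃++ b∈ys
  ... | ys₁ , ys₂ , refl = subst (suc (length xs) ≤_) (sym (↭-length (shift b ys₁ ys₂))) (s≤s (length-mono d f′))
    where
    f′ : xs ⋐ (ys₁ ++ ys₂)
    f′ q with f (there q)
    ... | b′ , b′∈ , a′~b′ with ∈-++⁻ ys₁ b′∈
    ... | inj₁ p = b′ , ∈-++⁺ˡ p , a′~b′
    ... | inj₂ (here refl) = ⊥-elim (All.lookup a≁xs q (~-trans a~b (~-sym a′~b′)))
    ... | inj₂ (there p) = b′ , ∈-++⁺ʳ ys₁ p , a′~b′

  length-strictMono : ∀ {xs ys y} → Distinct xs → xs ⋐ ys → y ∈ ys → (∀ {a} → a ∈ xs → ¬ (a ~ y)) →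
                      length xs < length ys
  length-strictMono {xs} {ys} {y} d f y∈ys y-new =
    length-mono (All.tabulate (λ q e → y-new q (~-sym e)) ∷ d) λ
      { (here refl) → y , y∈ys , ~-refl
      ; (there q) → f q }

Unique⇒length-mono : ∀ {X Y : List ℕ} → Unique X → X ⊆ Y → length X ≤ length Y
Unique⇒length-mono u X⊆Y = Pigeonhole.length-mono _≡_ refl sym trans u (λ {a} p → a , X⊆Y p , refl)

Unique⇒length-strictMono : ∀ {X Y : List ℕ} {y} → Unique X → X ⊆ Y → y ∈ Y → y ∉ X → length X < length Y
Unique⇒length-strictMono u X⊆Y y∈Y y∉X =
  Pigeonhole.length-strictMono _≡_ refl sym trans u (λ {a} p → a , X⊆Y p , refl) y∈Y λ { p refl → y∉X p }

module _ {A B : Set} {P : A → B → Set} where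

  Pointwise-∈ˡ : ∀ {xs ys x} → Pointwise P xs ys → x ∈ xs → ∃[ y ] (y ∈ ys × P x y)
  Pointwise-∈ˡ (p ∷ _) (here refl) = _ , here refl , p
  Pointwise-∈ˡ (_ ∷ ps) (there x∈) with Pointwise-∈ˡ ps x∈
  ... | y , y∈ , p = y , there y∈ , p

  Pointwise-∈ʳ : ∀ {xs ys y} → Pointwise P xs ys → y ∈ ys → ∃[ x ] (x ∈ xs × P x y)
  Pointwise-∈ʳ (p ∷ _) (here refl) = _ , here refl , p
  Pointwise-∈ʳ (_ ∷ ps) (there y∈) with Pointwise-∈ʳ ps y∈
  ... | x , x∈ , p = x , there x∈ , p

  Pointwise-map-∈ : ∀ {Q : A → B → Set} {xs ys} → (∀ {x y} → x ∈ xs → P x y → Q x y) →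
                    Pointwise P xs ys → Pointwise Q xs ys
  Pointwise-map-∈ f [] = []
  Pointwise-map-∈ f (p ∷ ps) = f (here refl) p ∷ Pointwise-map-∈ (f ∘ there) ps

≡ᵇ-pair : ∀ {a b c d} → T ((a ≡ᵇ c) ∧ (b ≡ᵇ d)) → a ≡ c × b ≡ d
≡ᵇ-pair h = let p , q = to T-∧ h in ≡ᵇ⇒≡ _ _ p , ≡ᵇ⇒≡ _ _ q

∧-mapʳ : ∀ a {b b′} → (T b → T b′) → T (a ∧ b) → T (a ∧ b′)
∧-mapʳ true b⇒b′ = b⇒b′

¬∧ʳ : ∀ a {b} → ¬ T b → ¬ T (a ∧ b)
¬∧ʳ true ¬b = ¬b

¬T⇒T-not : ∀ {b} → ¬ T b → T (not b)
¬T⇒T-not {false} _ = tt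
¬T⇒T-not {true} ¬b = ¬b tt

indicator-mono : ∀ {b b′} → (T b → T b′) → (if b then 1 else 0) ≤ (if b′ then 1 else 0)
indicator-mono {false} _ = z≤n
indicator-mono {true} {true} _ = s≤s z≤n
indicator-mono {true} {false} b⇒b′ = ⊥-elim (b⇒b′ tt)

indicator-strictMono : ∀ {b b′} → ¬ T b → T b′ → (if b then 1 else 0) < (if b′ then 1 else 0)
indicator-strictMono {false} {true} _ _ = s≤s z≤n
indicator-strictMono {true} ¬b _ = ⊥-elim (¬b tt)

≤ᵇ1≡false⇒2≤ : ∀ n → (n ≤ᵇ 1) ≡ false → 2 ≤ n
≤ᵇ1≡false⇒2≤ (suc (suc n)) _ = s≤s (s≤s z≤n)

2≤⇒≤ᵇ1≡false : ∀ {n} → 2 ≤ n → (n ≤ᵇ 1) ≡ false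
2≤⇒≤ᵇ1≡false (s≤s (s≤s _)) = refl

sum-concatMap : ∀ {A : Set} (h : A → List ℕ) xs → sum (concatMap h xs) ≡ sum (map (sum ∘ h) xs)
sum-concatMap h [] = refl
sum-concatMap h (x ∷ xs) = trans (sum-++ (h x) (concatMap h xs)) (cong (sum (h x) +_) (sum-concatMap h xs))

sum-map-mono : ∀ {A : Set} (f g : A → ℕ) xs → (∀ {x} → x ∈ xs → f x ≤ g x) → sum (map f xs) ≤ sum (map g xs)
sum-map-mono f g [] _ = z≤n
sum-map-mono f g (x ∷ xs) f≤g = +-mono-≤ (f≤g (here refl)) (sum-map-mono f g xs (f≤g ∘ there))

sum-map-strictMono : ∀ {A : Set} (f g : A → ℕ) xs → (∀ {x} → x ∈ xs → f x ≤ g x) →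
                     ∀ {x} → x ∈ xs → f x < g x → sum (map f xs) < sum (map g xs)
sum-map-strictMono f g (x ∷ xs) f≤g (here refl) fx<gx = +-mono-<-≤ fx<gx (sum-map-mono f g xs (f≤g ∘ there))
sum-map-strictMono f g (x ∷ xs) f≤g (there p) fy<gy =
  +-mono-≤-< (f≤g (here refl)) (sum-map-strictMono f g xs (f≤g ∘ there) p fy<gy)

tripleSum : (ℕ → ℕ → ℕ → ℕ) → List ℕ → ℕ
tripleSum g L = sum (map (λ x → sum (map (λ y → sum (map (λ z → g x y z) L)) L)) L)

tripleSum-↭ : ∀ g {L L′} → L ↭ L′ → tripleSum g L ≡ tripleSum g L′
tripleSum-↭ g {L} {L′} p =
  trans (sum-↭ (map⁺ _ p))
        (cong sum (map-cong (λ x → trans (sum-↭ (map⁺ _ p))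
                    (cong sum (map-cong (λ y → sum-↭ (map⁺ _ p)) L′))) L′))

≤-PointwiseOn : List ℕ → (ℕ → ℕ → ℕ → ℕ) → (ℕ → ℕ → ℕ → ℕ) → Set
≤-PointwiseOn L g g′ = ∀ {x y z} → x ∈ L → y ∈ L → z ∈ L → g x y z ≤ g′ x y z

tripleSum-strictMono : ∀ g g′ L → ≤-PointwiseOn L g g′ →
                       ∀ {x y z} → x ∈ L → y ∈ L → z ∈ L → g x y z < g′ x y z → tripleSum g L < tripleSum g′ L
tripleSum-strictMono g g′ L g≤g′ x∈L y∈L z∈L lt =
  sum-map-strictMono _ _ L (λ x∈ → sum-map-mono _ _ L (λ y∈ → sum-map-mono _ _ L (g≤g′ x∈ y∈))) x∈L
    (sum-map-strictMono _ _ L (λ y∈ → sum-map-mono _ _ L (g≤g′ x∈L y∈)) y∈L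
      (sum-map-strictMono _ _ L (g≤g′ x∈L y∈L) z∈L lt))

module _ (P : Tree → Set) (P-leaf : ∀ x → P (leaf x))
         (P-node : ∀ ts → (∀ {c} → c ∈ ts → P c) → P (node ts)) where
  mutual
    Tree-ind : ∀ t → P t
    Tree-ind (leaf x) = P-leaf x
    Tree-ind (node ts) = P-node ts (Forest-ind ts)

    Forest-ind : ∀ ts {c} → c ∈ ts → P c
    Forest-ind (t ∷ ts) (here refl) = Tree-ind t
    Forest-ind (t ∷ ts) (there p) = Forest-ind ts p

∈-leavesL⁺ : ∀ {ts c x} → c ∈ ts → x ∈ leaves c → x ∈ leavesL ts
∈-leavesL⁺ {t ∷ ts} (here refl) q = ∈-++⁺ˡ q
∈-leavesL⁺ {t ∷ ts} (there p) q = ∈-++⁺ʳ (leaves t) (∈-leavesL⁺ p q)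

∈-leavesL⁻ : ∀ {ts x} → x ∈ leavesL ts → ∃[ c ] (c ∈ ts × x ∈ leaves c)
∈-leavesL⁻ {t ∷ ts} q with ∈-++⁻ (leaves t) q
... | inj₁ p = t , here refl , p
... | inj₂ p with ∈-leavesL⁻ {ts} p
... | c , c∈ts , x∈c = c , there c∈ts , x∈c

∈-clustersL⁺ : ∀ {ts c K} → c ∈ ts → K ∈ clusters c → K ∈ clustersL ts
∈-clustersL⁺ {t ∷ ts} (here refl) q = ∈-++⁺ˡ q
∈-clustersL⁺ {t ∷ ts} (there p) q = ∈-++⁺ʳ (clusters t) (∈-clustersL⁺ p q)

∈-clustersL⁻ : ∀ {ts K} → K ∈ clustersL ts → ∃[ c ] (c ∈ ts × K ∈ clusters c)
∈-clustersL⁻ {t ∷ ts} q with ∈-++⁻ (clusters t) q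
... | inj₁ p = t , here refl , p
... | inj₂ p with ∈-clustersL⁻ {ts} p
... | c , c∈ts , K∈c = c , there c∈ts , K∈c

leaves∈clusters : ∀ t → leaves t ∈ clusters t
leaves∈clusters (leaf x) = here refl
leaves∈clusters (node ts) = here refl

singleton∈clusters : ∀ t {x} → x ∈ leaves t → (x ∷ []) ∈ clusters t
singleton∈clusters = Tree-ind _ (λ { x (here refl) → here refl }) λ ts ih p →
  let c , c∈ts , x∈c = ∈-leavesL⁻ {ts} p in there (∈-clustersL⁺ c∈ts (ih c∈ts x∈c))

cluster⊆leaves : ∀ t {K} → K ∈ clusters t → K ⊆ leaves t
cluster⊆leaves = Tree-ind _ (λ { x (here refl) q → q }) λ
  { ts ih (here refl) q → q
  ; ts ih (there p) q → let c , c∈ts , K∈c = ∈-clustersL⁻ {ts} p in ∈-leavesL⁺ c∈ts (ih c∈ts K∈c q) }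

clusterL⊆leavesL : ∀ ts {K} → K ∈ clustersL ts → K ⊆ leavesL ts
clusterL⊆leavesL ts = cluster⊆leaves (node ts) ∘ there

mutual
  size≡length-clusters : ∀ t → size t ≡ length (clusters t)
  size≡length-clusters (leaf x) = refl
  size≡length-clusters (node ts) = cong suc (sizeL≡length-clustersL ts)

  sizeL≡length-clustersL : ∀ ts → sizeL ts ≡ length (clustersL ts)
  sizeL≡length-clustersL [] = refl
  sizeL≡length-clustersL (t ∷ ts) =
    trans (cong₂ _+_ (size≡length-clusters t) (sizeL≡length-clustersL ts))
          (sym (length-++ (clusters t)))

PhyloForest : List Tree → Set
PhyloForest ts = BranchedL ts × Unique (leavesL ts)

Branched-child : ∀ {ts c} → BranchedL ts → c ∈ ts → Branched c
Branched-child {t ∷ ts} (b , _) (here refl) = b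
Branched-child {t ∷ ts} (_ , bs) (there p) = Branched-child bs p

Unique-child : ∀ {ts c} → Unique (leavesL ts) → c ∈ ts → Unique (leaves c)
Unique-child {t ∷ ts} u (here refl) = Unique-++⁻ˡ u
Unique-child {t ∷ ts} u (there p) = Unique-child (Unique-++⁻ʳ {leaves t} u) p

Phylo-child : ∀ {ts c} → PhyloForest ts → c ∈ ts → Phylo c
Phylo-child (bs , u) c∈ts = Branched-child bs c∈ts , Unique-child u c∈ts

leaves-nonempty : ∀ t → Branched t → ∃[ x ] (x ∈ leaves t)
leaves-nonempty (leaf x) _ = x , here refl
leaves-nonempty (node (t ∷ ts)) (_ , b , _) with leaves-nonempty t b
... | x , x∈t = x , ∈-++⁺ˡ x∈t

cluster-nonempty : ∀ t {K} → Branched t → K ∈ clusters t → ∃[ x ] (x ∈ K)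
cluster-nonempty = Tree-ind _ (λ { x _ (here refl) → x , here refl }) λ
  { ts ih b (here refl) → leaves-nonempty (node ts) b
  ; ts ih (_ , bs) (there p) → let c , c∈ts , K∈c = ∈-clustersL⁻ {ts} p in ih c∈ts (Branched-child bs c∈ts) K∈c }

clusterL-nonempty : ∀ ts {K} → BranchedL ts → K ∈ clustersL ts → ∃[ x ] (x ∈ K)
clusterL-nonempty ts bs K∈ts with ∈-clustersL⁻ {ts} K∈ts
... | c , c∈ts , K∈c = cluster-nonempty c (Branched-child bs c∈ts) K∈c

leaf-determines-child : ∀ {ts c d x} → Unique (leavesL ts) → c ∈ ts → d ∈ ts →
                        x ∈ leaves c → x ∈ leaves d → c ≡ d
leaf-determines-child {t ∷ ts} u (here refl) (here refl) _ _ = refl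
leaf-determines-child {t ∷ ts} u (here refl) (there d∈) x∈c x∈d =
  ⊥-elim (Unique-++⇒Disjoint {leaves t} u (x∈c , ∈-leavesL⁺ d∈ x∈d))
leaf-determines-child {t ∷ ts} u (there c∈) (here refl) x∈c x∈d =
  ⊥-elim (Unique-++⇒Disjoint {leaves t} u (x∈d , ∈-leavesL⁺ c∈ x∈c))
leaf-determines-child {t ∷ ts} u (there c∈) (there d∈) x∈c x∈d =
  leaf-determines-child (Unique-++⁻ʳ {leaves t} u) c∈ d∈ x∈c x∈d

cluster-of-child : ∀ {ts c x K} → Unique (leavesL ts) → c ∈ ts → x ∈ leaves c →
                   K ∈ clustersL ts → x ∈ K → K ∈ clusters c
cluster-of-child {ts} u c∈ts x∈c K∈ts x∈K with ∈-clustersL⁻ {ts} K∈ts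
... | d , d∈ts , K∈d with leaf-determines-child u c∈ts d∈ts x∈c (cluster⊆leaves d K∈d x∈K)
... | refl = K∈d

proper-cluster-misses-leaf : ∀ {ts K} → Phylo (node ts) → K ∈ clustersL ts → ∃[ e ] (e ∈ leavesL ts × e ∉ K)
proper-cluster-misses-leaf {t₁ ∷ t₂ ∷ ts} {K} ((_ , b₁ , b₂ , _) , u) K∈ts with ∈-clustersL⁻ {t₁ ∷ t₂ ∷ ts} K∈ts
... | c , here refl , K∈t₁ =
  let e , e∈t₂ = leaves-nonempty t₂ b₂
      e∈ts = ∈-++⁺ʳ (leaves t₁) (∈-++⁺ˡ e∈t₂)
  in e , e∈ts , λ e∈K → Unique-++⇒Disjoint {leaves t₁} u (cluster⊆leaves t₁ K∈t₁ e∈K , ∈-++⁺ˡ e∈t₂)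
... | c , there c∈ts , K∈c =
  let e , e∈t₁ = leaves-nonempty t₁ b₁
  in e , ∈-++⁺ˡ e∈t₁ , λ e∈K → Unique-++⇒Disjoint {leaves t₁} u (e∈t₁ , ∈-leavesL⁺ c∈ts (cluster⊆leaves c K∈c e∈K))
proper-cluster-misses-leaf {_ ∷ []} ((s≤s () , _) , _) _

open Pigeonhole {List ℕ} SameSet SameSet-refl SameSet-sym SameSet-trans
  using () renaming (Distinct to DistinctSets; _⋐_ to _⊑_; length-strictMono to ⊑-length-strictMono)

mutual
  clusters-distinct : ∀ t → Phylo t → DistinctSets (clusters t)
  clusters-distinct (leaf x) _ = [] ∷ []
  clusters-distinct (node ts) p@((_ , bs) , u) =
    All.tabulate (λ K∈ts s → let e , e∈ts , e∉K = proper-cluster-misses-leaf p K∈ts in e∉K (proj₁ (s e) e∈ts))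
    ∷ clustersL-distinct ts (bs , u)

  clustersL-distinct : ∀ ts → PhyloForest ts → DistinctSets (clustersL ts)
  clustersL-distinct [] _ = []
  clustersL-distinct (t ∷ ts) ((b , bs) , u) =
    AllPairs.++⁺ (clusters-distinct t (b , Unique-++⁻ˡ u)) (clustersL-distinct ts (bs , Unique-++⁻ʳ {leaves t} u))
      (All.tabulate λ K∈t → All.tabulate λ K′∈ts s →
        let e , e∈K = cluster-nonempty t b K∈t
        in Unique-++⇒Disjoint {leaves t} u
             (cluster⊆leaves t K∈t e∈K , clusterL⊆leavesL ts K′∈ts (proj₁ (s e) e∈K)))

-- Displayed triples are the triples separated by a cluster

Separates : Tree → ℕ → ℕ → ℕ → Set
Separates t x y z = ∃[ K ] (K ∈ clusters t × x ∈ K × y ∈ K × z ∉ K)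

Separates-swap : ∀ {t x y z} → Separates t x y z → Separates t y x z
Separates-swap (K , K∈t , x∈K , y∈K , z∉K) = K , K∈t , y∈K , x∈K , z∉K

Separates⇔Separates-child : ∀ {ts c x y z} → Unique (leavesL ts) → c ∈ ts → x ∈ leaves c → z ∈ leavesL ts →
                            Separates (node ts) x y z ⇔ Separates c x y z
Separates⇔Separates-child u c∈ts x∈c z∈ts = mk⇔
  (λ { (_ , here refl , _ , _ , z∉K) → ⊥-elim (z∉K z∈ts)
     ; (K , there K∈ts , x∈K , rest) → K , cluster-of-child u c∈ts x∈c K∈ts x∈K , x∈K , rest })
  (λ { (K , K∈c , rest) → K , there (∈-clustersL⁺ c∈ts K∈c) , rest })

allIn : List ℕ → Tree → Bool
allIn X t = all (λ w → elemB w (leaves t)) X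

childIndex : ∀ {ts : List Tree} {c} → ℕ → c ∈ ts → ℕ
childIndex i (here _) = i
childIndex i (there p) = childIndex (suc i) p

module _ {x : ℕ} {X : List ℕ} where

  lcaPathL-absent : ∀ {ts i} → (∀ {t} → t ∈ ts → x ∉ leaves t) → lcaPathL i (x ∷ X) ts ≡ []
  lcaPathL-absent {[]} _ = refl
  lcaPathL-absent {t ∷ ts} x∉ rewrite ∉⇒elemB≡false (x∉ (here refl)) = lcaPathL-absent (x∉ ∘ there)

  lcaPathL-child : ∀ {ts c i} → Unique (leavesL ts) → (p : c ∈ ts) → x ∈ leaves c →
                   lcaPathL i (x ∷ X) ts ≡ (if allIn (x ∷ X) c then childIndex i p ∷ lcaPath (x ∷ X) c else [])
  lcaPathL-child {t ∷ ts} u (here refl) x∈t with allIn (x ∷ X) t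
  ... | true = refl
  ... | false = lcaPathL-absent {ts} λ t′∈ts x∈t′ → Unique-++⇒Disjoint {leaves t} u (x∈t , ∈-leavesL⁺ t′∈ts x∈t′)
  lcaPathL-child {t ∷ ts} u (there p) x∈c
    rewrite ∉⇒elemB≡false (λ x∈t → Unique-++⇒Disjoint {leaves t} u (x∈t , ∈-leavesL⁺ p x∈c)) =
    lcaPathL-child {ts} {i = suc _} (Unique-++⁻ʳ {leaves t} u) p x∈c

properPrefix-∷ : ∀ k a b → properPrefix (k ∷ a) (k ∷ b) ≡ properPrefix a b
properPrefix-∷ k a b = cong (_∧ properPrefix a b) (to T-≡ (≡⇒≡ᵇ k k refl))

DisplayedByLca : Tree → ℕ → ℕ → ℕ → Set
DisplayedByLca t x y z = T (properPrefix (lcaPath (x ∷ y ∷ z ∷ []) t) (lcaPath (x ∷ y ∷ []) t))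

DisplayedByLca⇔Separates : ∀ t {x y z} → Unique (leaves t) → x ∈ leaves t → z ∈ leaves t →
                           DisplayedByLca t x y z ⇔ Separates t x y z
DisplayedByLca⇔Separates = Tree-ind _ leaf-case node-case
  where
  leaf-case : ∀ w {x y z} → Unique (w ∷ []) → x ∈ w ∷ [] → z ∈ w ∷ [] →
              DisplayedByLca (leaf w) x y z ⇔ Separates (leaf w) x y z
  leaf-case w _ _ (here refl) = mk⇔ (λ ()) λ { (_ , here refl , _ , _ , z∉K) → ⊥-elim (z∉K (here refl)) }
  node-case : ∀ ts → (∀ {c} → c ∈ ts → ∀ {x y z} → Unique (leaves c) → x ∈ leaves c → z ∈ leaves c →
                      DisplayedByLca c x y z ⇔ Separates c x y z) →
              ∀ {x y z} → Unique (leavesL ts) → x ∈ leavesL ts → z ∈ leavesL ts →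
              DisplayedByLca (node ts) x y z ⇔ Separates (node ts) x y z
  node-case ts ih {x} {y} {z} u x∈ts z∈ts with ∈-leavesL⁻ {ts} x∈ts
  ... | c , p , x∈c
    rewrite lcaPathL-child {X = y ∷ z ∷ []} {i = 0} u p x∈c | lcaPathL-child {X = y ∷ []} {i = 0} u p x∈c
          | ∈⇒elemB≡true x∈c
    -- Whether y and z lie in the child c of x decides which of the two lca paths stops at the root.
    with elemB y (leaves c) in ey | elemB z (leaves c) in ez
  ... | true | true rewrite properPrefix-∷ (childIndex 0 p) (lcaPath (x ∷ y ∷ z ∷ []) c) (lcaPath (x ∷ y ∷ []) c) =
    ⇔-sym (Separates⇔Separates-child u p x∈c z∈ts) ⇔-∘ ih p (Unique-child u p) x∈c (elemB≡true⇒∈ ez)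
  ... | true | false =
    mk⇔ (λ _ → leaves c , there (∈-clustersL⁺ p (leaves∈clusters c)) , x∈c , elemB≡true⇒∈ ey , elemB≡false⇒∉ ez)
        (λ _ → _)
  ... | false | _ = mk⇔ (λ ())
    λ { (_ , here refl , _ , _ , z∉K) → z∉K z∈ts
      ; (K , there K∈ts , x∈K , y∈K , _) →
          elemB≡false⇒∉ ey (cluster⊆leaves c (cluster-of-child u p x∈c K∈ts x∈K) y∈K) }

displaysB⇔Separates : ∀ t {x y z} → Unique (leaves t) →
  T (displaysB t x y z) ⇔ (x ∈ leaves t × y ∈ leaves t × z ∈ leaves t × Separates t x y z)
displaysB⇔Separates t {x} {y} {z} u = mk⇔ decompose compose
  where
  decompose : T (displaysB t x y z) → x ∈ leaves t × y ∈ leaves t × z ∈ leaves t × Separates t x y z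
  decompose d with to T-∧ d
  ... | x∈ , d′ with to T-∧ d′
  ... | y∈ , d″ with to T-∧ d″
  ... | z∈ , lca =
    let x∈t = to T-elemB⇔∈ x∈ ; z∈t = to T-elemB⇔∈ z∈
    in x∈t , to T-elemB⇔∈ y∈ , z∈t , to (DisplayedByLca⇔Separates t u x∈t z∈t) lca
  compose : x ∈ leaves t × y ∈ leaves t × z ∈ leaves t × Separates t x y z → T (displaysB t x y z)
  compose (x∈t , y∈t , z∈t , s) =
    from T-∧ (from T-elemB⇔∈ x∈t , from T-∧ (from T-elemB⇔∈ y∈t ,
    from T-∧ (from T-elemB⇔∈ z∈t , from (DisplayedByLca⇔Separates t u x∈t z∈t) s)))

SeparatesOn : List Triple → List ℕ → Tree → Set
SeparatesOn R S t = ∀ {r} → r ∈ R → tx r ∈ S → ty r ∈ S → tz r ∈ S → Separates t (tx r) (ty r) (tz r)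

⊑-trans : ∀ {A B C} → A ⊑ B → B ⊑ C → A ⊑ C
⊑-trans f g K∈A with f K∈A
... | K′ , K′∈B , K~K′ with g K′∈B
... | K″ , K″∈C , K′~K″ = K″ , K″∈C , SameSet-trans K~K′ K′~K″

Refines⇒⊑ : ∀ {s t} → Refines s t → clusters t ⊑ clusters s
Refines⇒⊑ r K∈t = find (All.lookup r K∈t)

⊑⇒leaves⊆ : ∀ a b → clusters a ⊑ clusters b → leaves a ⊆ leaves b
⊑⇒leaves⊆ a b f x∈a with f (leaves∈clusters a)
... | K′ , K′∈b , a~K′ = cluster⊆leaves b K′∈b (proj₁ (a~K′ _) x∈a)

⊑-children : ∀ {as bs} → Phylo (node as) → clusters (node as) ⊑ clusters (node bs) → clustersL as ⊑ clustersL bs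
⊑-children {as} {bs} p f K∈as with f (there K∈as)
... | K′ , there K′∈bs , K~K′ = K′ , K′∈bs , K~K′
... | _ , here refl , K~bs with proper-cluster-misses-leaf p K∈as
... | e , e∈as , e∉K = ⊥-elim (e∉K (proj₂ (K~bs e) (⊑⇒leaves⊆ (node as) (node bs) f e∈as)))

child⊆child : ∀ {as bs c d v} → Unique (leavesL as) → clustersL bs ⊑ clustersL as →
              d ∈ bs → c ∈ as → v ∈ leaves d → v ∈ leaves c → leaves d ⊆ leaves c
child⊆child {d = d} u f d∈bs c∈as v∈d v∈c with f (∈-clustersL⁺ d∈bs (leaves∈clusters d))
... | K′ , K′∈as , d~K′ =
  cluster⊆leaves _ (cluster-of-child u c∈as v∈c K′∈as (proj₁ (d~K′ _) v∈d)) ∘ proj₁ (d~K′ _)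

⊑-child : ∀ {as bs c d v} → Unique (leavesL as) → BranchedL bs → clustersL bs ⊑ clustersL as →
          d ∈ bs → c ∈ as → v ∈ leaves d → v ∈ leaves c → clusters d ⊑ clusters c
⊑-child {d = d} u bs f d∈bs c∈as v∈d v∈c K∈d with f (∈-clustersL⁺ d∈bs K∈d)
... | K′ , K′∈as , K~K′ =
  let e , e∈K = cluster-nonempty d (Branched-child bs d∈bs) K∈d
      e∈c = child⊆child u f d∈bs c∈as v∈d v∈c (cluster⊆leaves d K∈d e∈K)
  in K′ , cluster-of-child u c∈as e∈c K′∈as (proj₁ (K~K′ e) e∈K) , K~K′

-- Mutually included cluster systems give isomorphic trees

module _ {a : Tree} where

  ∈-clustersL-remove⁻ : ∀ pre {post K} → K ∈ clustersL (pre ++ a ∷ post) →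
                        K ∈ clusters a ⊎ K ∈ clustersL (pre ++ post)
  ∈-clustersL-remove⁻ [] p = ∈-++⁻ (clusters a) p
  ∈-clustersL-remove⁻ (t ∷ pre) p with ∈-++⁻ (clusters t) p
  ... | inj₁ q = inj₂ (∈-++⁺ˡ q)
  ... | inj₂ q with ∈-clustersL-remove⁻ pre q
  ... | inj₁ r = inj₁ r
  ... | inj₂ r = inj₂ (∈-++⁺ʳ (clusters t) r)

  ∈-clustersL-remove⁺ : ∀ pre {post K} → K ∈ clustersL (pre ++ post) → K ∈ clustersL (pre ++ a ∷ post)
  ∈-clustersL-remove⁺ [] p = ∈-++⁺ʳ (clusters a) p
  ∈-clustersL-remove⁺ (t ∷ pre) p with ∈-++⁻ (clusters t) p
  ... | inj₁ q = ∈-++⁺ˡ q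
  ... | inj₂ q = ∈-++⁺ʳ (clusters t) (∈-clustersL-remove⁺ pre q)

  ∈-leavesL-remove⁺ : ∀ pre {post e} → e ∈ leavesL (pre ++ post) → e ∈ leavesL (pre ++ a ∷ post)
  ∈-leavesL-remove⁺ [] p = ∈-++⁺ʳ (leaves a) p
  ∈-leavesL-remove⁺ (t ∷ pre) p with ∈-++⁻ (leaves t) p
  ... | inj₁ q = ∈-++⁺ˡ q
  ... | inj₂ q = ∈-++⁺ʳ (leaves t) (∈-leavesL-remove⁺ pre q)

  Disjoint-leavesL-remove : ∀ pre {post} → Unique (leavesL (pre ++ a ∷ post)) →
                            Disjoint (leaves a) (leavesL (pre ++ post))
  Disjoint-leavesL-remove [] u = Unique-++⇒Disjoint {leaves a} u
  Disjoint-leavesL-remove (t ∷ pre) u (e∈a , e∈rest) with ∈-++⁻ (leaves t) e∈rest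
  ... | inj₁ e∈t = Unique-++⇒Disjoint {leaves t} u (e∈t , ∈-leavesL⁺ (∈-++⁺ʳ pre (here refl)) e∈a)
  ... | inj₂ e∈ = Disjoint-leavesL-remove pre (Unique-++⁻ʳ {leaves t} u) (e∈a , e∈)

  PhyloForest-remove : ∀ pre {post} → PhyloForest (pre ++ a ∷ post) → PhyloForest (pre ++ post)
  PhyloForest-remove [] ((_ , bs) , u) = bs , Unique-++⁻ʳ {leaves a} u
  PhyloForest-remove (t ∷ pre) ((b , bs) , u) =
    let bs′ , u′ = PhyloForest-remove pre (bs , Unique-++⁻ʳ {leaves t} u)
    in (b , bs′) , Unique.++⁺ (Unique-++⁻ˡ u) u′ λ (e∈t , e∈rest) →
         Unique-++⇒Disjoint {leaves t} u (e∈t , ∈-leavesL-remove⁺ pre e∈rest)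

⊑-remove : ∀ {x y} P Q P′ Q′ → PhyloForest (P ++ x ∷ Q) → leaves y ⊆ leaves x →
           clustersL (P ++ x ∷ Q) ⊑ clustersL (P′ ++ y ∷ Q′) → clustersL (P ++ Q) ⊑ clustersL (P′ ++ Q′)
⊑-remove P Q P′ Q′ p y⊆x f K∈ with f (∈-clustersL-remove⁺ P K∈)
... | K′ , K′∈ , K~K′ with ∈-clustersL-remove⁻ P′ K′∈
... | inj₂ K′∈rest = K′ , K′∈rest , K~K′
... | inj₁ K′∈y =
  let e , e∈K = clusterL-nonempty (P ++ Q) (proj₁ (PhyloForest-remove P p)) K∈
  in ⊥-elim (Disjoint-leavesL-remove P (proj₂ p)
       (y⊆x (cluster⊆leaves _ K′∈y (proj₁ (K~K′ e) e∈K)) , clusterL⊆leavesL (P ++ Q) K∈ e∈K))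

matching-child : ∀ {as b bs} → PhyloForest as → PhyloForest (b ∷ bs) →
                 clustersL as ⊑ clustersL (b ∷ bs) → clustersL (b ∷ bs) ⊑ clustersL as →
                 ∃[ a ] (a ∈ as × SameSet (leaves a) (leaves b))
matching-child {as} {b} {bs} pa ((bb , _) , ub) f g with g (∈-++⁺ˡ (leaves∈clusters b))
... | K , K∈as , b~K with ∈-clustersL⁻ {as} K∈as
... | a , a∈as , K∈a =
  a , a∈as , λ x → child⊆child {as = b ∷ bs} {bs = as} {b} {a} ub f a∈as (here refl) (b⊆a e∈b) e∈b , b⊆a
  where
  b⊆a : leaves b ⊆ leaves a
  b⊆a = cluster⊆leaves a K∈a ∘ proj₁ (b~K _)
  e∈b = proj₂ (leaves-nonempty b bb)

node⋢leaf : ∀ {ts y} → Phylo (node ts) → ¬ (clusters (node ts) ⊑ clusters (leaf y))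
node⋢leaf {t ∷ ts} p f with f (here refl) | f (there (∈-++⁺ˡ (leaves∈clusters t)))
... | _ , here refl , root~y | _ , here refl , t~y with proper-cluster-misses-leaf p (∈-++⁺ˡ (leaves∈clusters t))
... | e , e∈ts , e∉t = e∉t (proj₂ (t~y e) (proj₁ (root~y e) e∈ts))

mutual
  ⊑-antisym⇒≅ : ∀ a b → Phylo a → Phylo b → clusters a ⊑ clusters b → clusters b ⊑ clusters a → a ≅ b
  ⊑-antisym⇒≅ (leaf x) (leaf y) _ _ f _ with f (here refl)
  ... | _ , here refl , x~y with proj₁ (x~y x) (here refl)
  ... | here refl = leaf≅
  ⊑-antisym⇒≅ (node as) (leaf y) pa _ f _ = ⊥-elim (node⋢leaf pa f)
  ⊑-antisym⇒≅ (leaf x) (node bs) _ pb _ g = ⊥-elim (node⋢leaf pb g)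
  ⊑-antisym⇒≅ (node as) (node bs) pa@((_ , ba) , ua) pb@((_ , bb) , ub) f g
    with ⊑-antisym⇒↭≅ as bs (ba , ua) (bb , ub) (⊑-children {as} {bs} pa f) (⊑-children {bs} {as} pb g)
  ... | vs , as↭vs , vs≅bs = node≅ as↭vs vs≅bs

  ⊑-antisym⇒↭≅ : ∀ as bs → PhyloForest as → PhyloForest bs →
                  clustersL as ⊑ clustersL bs → clustersL bs ⊑ clustersL as →
                  ∃[ vs ] (as ↭ vs × Pointwise _≅_ vs bs)
  ⊑-antisym⇒↭≅ [] [] _ _ _ _ = [] , ↭-refl , []
  ⊑-antisym⇒↭≅ (a ∷ as) [] _ _ f _ with f (∈-++⁺ˡ (leaves∈clusters a))
  ... | _ , () , _
  ⊑-antisym⇒↭≅ as (b ∷ bs) pa pb@((bb , bbs) , ub) f g with matching-child pa pb f g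
  ... | a , a∈as , a~b with leaves-nonempty a (Branched-child (proj₁ pa) a∈as) | ∈-∃++ a∈as
  ... | e , e∈a | pre , post , refl
    with ⊑-antisym⇒↭≅ (pre ++ post) bs (PhyloForest-remove pre pa) (bbs , Unique-++⁻ʳ {leaves b} ub)
           (⊑-remove pre post [] bs pa (proj₂ (a~b _)) f) (⊑-remove [] bs pre post pb (proj₁ (a~b _)) g)
  ... | vs , rest↭vs , vs≅bs =
    a ∷ vs , ↭-trans (shift a pre post) (prep a rest↭vs) ,
    ⊑-antisym⇒≅ a b (Phylo-child pa a∈as) (Phylo-child pb (here refl))
      (⊑-child {b ∷ bs} {as} ub (proj₁ pa) f a∈as (here refl) e∈a (proj₁ (a~b e) e∈a))
      (⊑-child {as} {b ∷ bs} (proj₂ pa) (bb , bbs) g (here refl) a∈as (proj₁ (a~b e) e∈a) e∈a)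
    ∷ vs≅bs

-- Minimal trees displaying a triple set

⊑-antisym-by-size : ∀ t s → Phylo t → clusters t ⊑ clusters s → size s ≤ size t → clusters s ⊑ clusters t
⊑-antisym-by-size t s pt t⊑s s≤t {K} K∈s with find-SameSet K (clusters t)
... | inj₁ K∈t = K∈t
... | inj₂ K∉t = ⊥-elim (<-irrefl refl (<-≤-trans more-clusters
                   (subst₂ _≤_ (size≡length-clusters s) (size≡length-clusters t) s≤t)))
  where
  more-clusters : length (clusters t) < length (clusters s)
  more-clusters = ⊑-length-strictMono (clusters-distinct t pt) t⊑s K∈s K∉t

ClusterOrUnseparated : Tree → List ℕ → Set
ClusterOrUnseparated t K =
  (∃[ K′ ] (K′ ∈ clusters t × SameSet K K′)) ⊎
  (∃[ x ] ∃[ y ] ∃[ z ] (x ∈ K × y ∈ K × z ∈ leaves t × z ∉ K × ¬ Separates t x y z))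

cluster-or-unseparated : ∀ t {K} → Unique (leaves t) → ∃[ x ] (x ∈ K) → K ⊆ leaves t → ClusterOrUnseparated t K
cluster-or-unseparated = Tree-ind _ leaf-case node-case
  where
  leaf-case : ∀ w {K} → Unique (w ∷ []) → ∃[ x ] (x ∈ K) → K ⊆ w ∷ [] → ClusterOrUnseparated (leaf w) K
  leaf-case w _ (x , x∈K) K⊆w = inj₁ (w ∷ [] , here refl , λ _ → K⊆w , λ { (here refl) → w∈K })
    where
    w∈K : w ∈ _
    w∈K with K⊆w x∈K
    ... | here refl = x∈K
  node-case : ∀ ts → (∀ {c} → c ∈ ts → ∀ {K} → Unique (leaves c) → ∃[ x ] (x ∈ K) → K ⊆ leaves c →
                        ClusterOrUnseparated c K) →
              ∀ {K} → Unique (leavesL ts) → ∃[ x ] (x ∈ K) → K ⊆ leavesL ts → ClusterOrUnseparated (node ts) K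
  node-case ts ih {K} u (x , x∈K) K⊆ts with ⊆-or-witness (leavesL ts) K
  ... | inj₁ ts⊆K = inj₁ (leavesL ts , here refl , λ _ → K⊆ts , ts⊆K)
  ... | inj₂ (z , z∈ts , z∉K) with ∈-leavesL⁻ {ts} (K⊆ts x∈K)
  ... | c , c∈ts , x∈c with ⊆-or-witness K (leaves c)
  ... | inj₂ (y , y∈K , y∉c) =
    inj₂ (x , y , z , x∈K , y∈K , z∈ts , z∉K ,
          λ s → let (K′ , K′∈c , _ , y∈K′ , _) = to (Separates⇔Separates-child u c∈ts x∈c z∈ts) s
                in y∉c (cluster⊆leaves c K′∈c y∈K′))
  ... | inj₁ K⊆c with ih c∈ts (Unique-child u c∈ts) (x , x∈K) K⊆c
  ... | inj₁ (K′ , K′∈c , K~K′) = inj₁ (K′ , there (∈-clustersL⁺ c∈ts K′∈c) , K~K′)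
  ... | inj₂ (x′ , y′ , z′ , x′∈K , y′∈K , z′∈c , z′∉K , ¬sep) =
    inj₂ (x′ , y′ , z′ , x′∈K , y′∈K , ∈-leavesL⁺ c∈ts z′∈c , z′∉K ,
          ¬sep ∘ to (Separates⇔Separates-child u c∈ts (K⊆c x′∈K) (∈-leavesL⁺ c∈ts z′∈c)))

countedTriple : Tree → ℕ → ℕ → ℕ → ℕ
countedTriple t x y z = if (x <ᵇ y) ∧ not (z ≡ᵇ x) ∧ not (z ≡ᵇ y) ∧ displaysB t x y z then 1 else 0

tripleCount≡tripleSum : ∀ t → tripleCount t ≡ tripleSum (countedTriple t) (leaves t)
tripleCount≡tripleSum t =
  trans (sum-concatMap (λ x → concatMap (λ y → map (countedTriple t x y) L) L) L)
        (cong sum (map-cong (λ x → sum-concatMap (λ y → map (countedTriple t x y) L) L) L))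
  where L = leaves t

Separates-mono : ∀ {t s x y z} → clusters t ⊑ clusters s → Separates t x y z → Separates s x y z
Separates-mono t⊑s (K , K∈t , x∈K , y∈K , z∉K) with t⊑s K∈t
... | K′ , K′∈s , K~K′ = K′ , K′∈s , proj₁ (K~K′ _) x∈K , proj₁ (K~K′ _) y∈K , z∉K ∘ proj₂ (K~K′ _)

displaysB-mono : ∀ {t s x y z} → Unique (leaves t) → Unique (leaves s) → leaves t ⊆ leaves s →
                 clusters t ⊑ clusters s → T (displaysB t x y z) → T (displaysB s x y z)
displaysB-mono {t} {s} ut us t⊆s t⊑s d with to (displaysB⇔Separates t ut) d
... | x∈t , y∈t , z∈t , sep =
  from (displaysB⇔Separates s us) (t⊆s x∈t , t⊆s y∈t , t⊆s z∈t , Separates-mono t⊑s sep)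

tripleCount-strictMono : ∀ {t s x y z} → Phylo t → Phylo s → SameSet (leaves t) (leaves s) → clusters t ⊑ clusters s →
                         x ∈ leaves t → y ∈ leaves t → z ∈ leaves t → x < y → z ≢ x → z ≢ y →
                         Separates s x y z → ¬ Separates t x y z → tripleCount t < tripleCount s
tripleCount-strictMono {t} {s} {x} {y} {z} (_ , ut) (_ , us) t~s t⊑s x∈t y∈t z∈t x<y z≢x z≢y sep-s ¬sep-t =
  begin-strict
    tripleCount t
  ≡⟨ tripleCount≡tripleSum t ⟩
    tripleSum (countedTriple t) (leaves t)
  <⟨ tripleSum-strictMono _ _ (leaves t) counted-mono x∈t y∈t z∈t counted-< ⟩
    tripleSum (countedTriple s) (leaves t)
  ≡⟨ tripleSum-↭ (countedTriple s) (Unique∧SameSet⇒↭ ut us t~s) ⟩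
    tripleSum (countedTriple s) (leaves s)
  ≡⟨ sym (tripleCount≡tripleSum s) ⟩
    tripleCount s
  ∎
  where
  open ≤-Reasoning
  t⊆s : leaves t ⊆ leaves s
  t⊆s = proj₁ (t~s _)
  counted-mono : ≤-PointwiseOn (leaves t) (countedTriple t) (countedTriple s)
  counted-mono {a} {b} {c} _ _ _ =
    indicator-mono (∧-mapʳ (a <ᵇ b) (∧-mapʳ (not (c ≡ᵇ a)) (∧-mapʳ (not (c ≡ᵇ b))
      (displaysB-mono ut us t⊆s t⊑s))))
  counted-< : countedTriple t x y z < countedTriple s x y z
  counted-< = indicator-strictMono
    (¬∧ʳ (x <ᵇ y) (¬∧ʳ (not (z ≡ᵇ x)) (¬∧ʳ (not (z ≡ᵇ y))
      (¬sep-t ∘ proj₂ ∘ proj₂ ∘ proj₂ ∘ to (displaysB⇔Separates t ut)))))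
    (from T-∧ (<⇒<ᵇ x<y , from T-∧ (¬T⇒T-not (z≢x ∘ ≡ᵇ⇒≡ z x) ,
     from T-∧ (¬T⇒T-not (z≢y ∘ ≡ᵇ⇒≡ z y) ,
     from (displaysB⇔Separates s us) (t⊆s x∈t , t⊆s y∈t , t⊆s z∈t , sep-s)))))

unseparated⇒tripleCount-< : ∀ {t s K x y z} → Phylo t → Phylo s → SameSet (leaves t) (leaves s) →
                            clusters t ⊑ clusters s → K ∈ clusters s → x ∈ K → y ∈ K → z ∈ leaves t → z ∉ K →
                            ¬ Separates t x y z →
                            tripleCount t < tripleCount s
unseparated⇒tripleCount-< {t} {s} {K} {x} {y} {z} pt ps t~s t⊑s K∈s x∈K y∈K z∈t z∉K ¬sep = by-order (<-cmp x y)
  where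
  K⊆t : K ⊆ leaves t
  K⊆t = proj₂ (t~s _) ∘ cluster⊆leaves s K∈s
  separated-by-K : ∀ {a b} → a < b → a ∈ K → b ∈ K → ¬ Separates t a b z → tripleCount t < tripleCount s
  separated-by-K a<b a∈K b∈K = tripleCount-strictMono pt ps t~s t⊑s (K⊆t a∈K) (K⊆t b∈K) z∈t a<b
    (λ { refl → z∉K a∈K }) (λ { refl → z∉K b∈K }) (K , K∈s , a∈K , b∈K , z∉K)
  by-order : Tri (x < y) (x ≡ y) (y < x) → tripleCount t < tripleCount s
  by-order (tri< x<y _ _) = separated-by-K x<y x∈K y∈K ¬sep
  by-order (tri> _ _ y<x) = separated-by-K y<x y∈K x∈K (¬sep ∘ Separates-swap)
  by-order (tri≈ _ refl _) =
    ⊥-elim (¬sep (x ∷ [] , singleton∈clusters t (K⊆t x∈K) , here refl , here refl , λ { (here refl) → z∉K x∈K }))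

⊑-antisym-by-tripleCount : ∀ t s → Phylo t → Phylo s → SameSet (leaves t) (leaves s) → clusters t ⊑ clusters s →
                           tripleCount s ≤ tripleCount t → clusters s ⊑ clusters t
⊑-antisym-by-tripleCount t s pt ps@(bs , _) t~s t⊑s s≤t {K} K∈s with find-SameSet K (clusters t)
... | inj₁ K∈t = K∈t
... | inj₂ K∉t
  with cluster-or-unseparated t (proj₂ pt) (cluster-nonempty s bs K∈s) (proj₂ (t~s _) ∘ cluster⊆leaves s K∈s)
... | inj₁ (K′ , K′∈t , K~K′) = ⊥-elim (K∉t K′∈t (SameSet-sym K~K′))
... | inj₂ (x , y , z , x∈K , y∈K , z∈t , z∉K , ¬sep) =
  ⊥-elim (<⇒≱ (unseparated⇒tripleCount-< pt ps t~s t⊑s K∈s x∈K y∈K z∈t z∉K ¬sep) s≤t)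

-- Connected components of the Aho graph

AhoEdge : List Triple → List ℕ → ℕ → ℕ → Set
AhoEdge R S a b = T (ahoEdge R S a b)

AhoEdge-sym : ∀ {R S a b} → AhoEdge R S a b → AhoEdge R S b a
AhoEdge-sym {R} {S} {a} {b} = subst T (ahoEdge-comm R)
  where
  ahoEdge-comm : ∀ R → ahoEdge R S a b ≡ ahoEdge R S b a
  ahoEdge-comm [] = refl
  ahoEdge-comm (r ∷ R) =
    cong₂ _∨_ (cong (_∧ elemB (tz r) S) (∨-comm ((tx r ≡ᵇ a) ∧ (ty r ≡ᵇ b)) ((tx r ≡ᵇ b) ∧ (ty r ≡ᵇ a))))
              (ahoEdge-comm R)

AhoEdge-intro : ∀ {R S r} → r ∈ R → tz r ∈ S → AhoEdge R S (tx r) (ty r)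
AhoEdge-intro {R} {S} {r} r∈R z∈S = any⁺ _ (lose r∈R (from T-∧
  (from T-∨ (inj₁ (from T-∧ (≡⇒≡ᵇ (tx r) (tx r) refl , ≡⇒≡ᵇ (ty r) (ty r) refl))) ,
   from T-elemB⇔∈ z∈S)))

AhoEdge-elim : ∀ {R S a b} → AhoEdge R S a b →
               ∃[ r ] (r ∈ R × ((tx r ≡ a × ty r ≡ b) ⊎ (tx r ≡ b × ty r ≡ a)) × tz r ∈ S)
AhoEdge-elim {R} e with find (any⁻ _ R e)
... | r , r∈R , holds with to T-∧ holds
... | ends , z∈S with to T-∨ ends
... | inj₁ xa-yb = r , r∈R , inj₁ (≡ᵇ-pair xa-yb) , to T-elemB⇔∈ z∈S
... | inj₂ xb-ya = r , r∈R , inj₂ (≡ᵇ-pair xb-ya) , to T-elemB⇔∈ z∈S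

module Components (R : List Triple) (S : List ℕ) where

  JoinsFrom : List ℕ → ℕ → Bool
  JoinsFrom C u = not (elemB u C) ∧ any (λ w → ahoEdge R S w u) C

  frontier : List ℕ → List ℕ
  frontier C = filter (λ u → T? (JoinsFrom C u)) S

  EdgeClosed : (ℕ → Set) → Set
  EdgeClosed P = ∀ {a b} → a ∈ S → b ∈ S → P a → AhoEdge R S a b → P b

  JoinsFrom⁻ : ∀ {C u} → T (JoinsFrom C u) → u ∉ C × ∃[ w ] (w ∈ C × AhoEdge R S w u)
  JoinsFrom⁻ {C} joins with to T-∧ joins
  ... | u∉C , adjacent = elemB≡false⇒∉ (to T-not-≡ u∉C) , find (any⁻ _ C adjacent)

  ∈-frontier⁻ : ∀ {C u} → u ∈ frontier C → u ∈ S × u ∉ C × ∃[ w ] (w ∈ C × AhoEdge R S w u)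
  ∈-frontier⁻ {C} p with ∈-filter⁻ (λ u → T? (JoinsFrom C u)) {xs = S} p
  ... | u∈S , joins = u∈S , JoinsFrom⁻ {C} joins

  grow-⊆ : ∀ {C} → C ⊆ S → grow R S C ⊆ S
  grow-⊆ {C} C⊆S p with ∈-++⁻ C p
  ... | inj₁ q = C⊆S q
  ... | inj₂ q = proj₁ (∈-frontier⁻ {C} q)

  iterGrow-⊆ : ∀ n {C} → C ⊆ S → iterGrow n R S C ⊆ S
  iterGrow-⊆ zero C⊆S = C⊆S
  iterGrow-⊆ (suc n) C⊆S = iterGrow-⊆ n (grow-⊆ C⊆S)

  grow-Unique : ∀ {C} → Unique S → Unique C → Unique (grow R S C)
  grow-Unique {C} uS uC = Unique.++⁺ uC (Unique.filter⁺ (λ u → T? (JoinsFrom C u)) uS)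
    λ (x∈C , x∈F) → proj₁ (proj₂ (∈-frontier⁻ {C} x∈F)) x∈C

  iterGrow-Unique : ∀ n {C} → Unique S → Unique C → Unique (iterGrow n R S C)
  iterGrow-Unique zero uS uC = uC
  iterGrow-Unique (suc n) uS uC = iterGrow-Unique n uS (grow-Unique uS uC)

  iterGrow-⊇ : ∀ n {C} → C ⊆ iterGrow n R S C
  iterGrow-⊇ zero = λ p → p
  iterGrow-⊇ (suc n) = iterGrow-⊇ n ∘ ∈-++⁺ˡ

  closed⇒frontier≡[] : ∀ {C} → C ⊆ S → EdgeClosed (_∈ C) → frontier C ≡ []
  closed⇒frontier≡[] {C} C⊆S closed = filter-none (λ u → T? (JoinsFrom C u)) (All.tabulate not-joining)
    where
    not-joining : ∀ {u} → u ∈ S → ¬ T (JoinsFrom C u)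
    not-joining u∈S joins with JoinsFrom⁻ {C} joins
    ... | u∉C , w , w∈C , e = u∉C (closed (C⊆S w∈C) u∈S w∈C e)

  closed⇒iterGrow≡ : ∀ n {C} → C ⊆ S → EdgeClosed (_∈ C) → iterGrow n R S C ≡ C
  closed⇒iterGrow≡ zero _ _ = refl
  closed⇒iterGrow≡ (suc n) {C} C⊆S closed
    rewrite closed⇒frontier≡[] C⊆S closed | ++-identityʳ C = closed⇒iterGrow≡ n C⊆S closed

  frontier≡[]⇒closed : ∀ {C} → frontier C ≡ [] → EdgeClosed (_∈ C)
  frontier≡[]⇒closed {C} F≡[] {a} {b} a∈S b∈S a∈C e with DecMembership._∈?_ _≟_ b C
  ... | yes b∈C = b∈C
  ... | no b∉C with subst (b ∈_) F≡[] (∈-filter⁺ (λ u → T? (JoinsFrom C u)) b∈S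
                      (from T-∧ (from T-not-≡ (∉⇒elemB≡false b∉C) , any⁺ _ (lose a∈C e))))
  ... | ()

  grow-length : ∀ {C f F} → frontier C ≡ f ∷ F → suc (length C) ≤ length (grow R S C)
  grow-length {C} {f} {F} F≡ rewrite length-++ C {frontier C} | F≡ | +-suc (length C) (length F) =
    s≤s (m≤m+n (length C) (length F))

  iterGrow-closed-or-long : ∀ n C → C ⊆ S → Unique S → Unique C →
                            EdgeClosed (_∈ iterGrow n R S C) ⊎ n + length C ≤ length (iterGrow n R S C)
  iterGrow-closed-or-long zero C _ _ _ = inj₂ ≤-refl
  iterGrow-closed-or-long (suc n) C C⊆S uS uC = by-frontier (frontier C) refl
    where
    by-frontier : ∀ F → frontier C ≡ F →
                  EdgeClosed (_∈ iterGrow (suc n) R S C) ⊎ suc n + length C ≤ length (iterGrow (suc n) R S C)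
    by-frontier [] F≡[] = inj₁ (subst (λ D → EdgeClosed (_∈ D)) (sym (closed⇒iterGrow≡ (suc n) C⊆S closed)) closed)
      where closed = frontier≡[]⇒closed F≡[]
    by-frontier (f ∷ F) F≡ with iterGrow-closed-or-long n (grow R S C) (grow-⊆ C⊆S) uS (grow-Unique uS uC)
    ... | inj₁ closed = inj₁ closed
    ... | inj₂ long = inj₂ (≤-trans (subst (_≤ n + length (grow R S C)) (+-suc n (length C))
                                              (+-monoʳ-≤ n (grow-length {C} F≡))) long)

  iterGrow-least : ∀ (P : ℕ → Set) → EdgeClosed P → ∀ n {C} → C ⊆ S → (∀ {c} → c ∈ C → P c) →
                   ∀ {u} → u ∈ iterGrow n R S C → P u
  iterGrow-least P closed zero _ PC = PC
  iterGrow-least P closed (suc n) {C} C⊆S PC = iterGrow-least P closed n (grow-⊆ C⊆S) P-grow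
    where
    P-grow : ∀ {c} → c ∈ grow R S C → P c
    P-grow q with ∈-++⁻ C q
    ... | inj₁ c∈C = PC c∈C
    ... | inj₂ c∈F with ∈-frontier⁻ {C} c∈F
    ... | c∈S , _ , w , w∈C , e = closed (C⊆S w∈C) c∈S (PC w∈C) e

  component-self : ∀ {v} → v ∈ component R S v
  component-self = iterGrow-⊇ (length S) (here refl)

  component-⊆ : ∀ {v} → v ∈ S → component R S v ⊆ S
  component-⊆ v∈S = iterGrow-⊆ (length S) λ { (here refl) → v∈S }

  component-Unique : ∀ {v} → Unique S → Unique (component R S v)
  component-Unique uS = iterGrow-Unique (length S) uS ([] ∷ [])

  component-least : ∀ (P : ℕ → Set) {v} → EdgeClosed P → v ∈ S → P v → ∀ {u} → u ∈ component R S v → P u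
  component-least P closed v∈S Pv =
    iterGrow-least P closed (length S) (λ { (here refl) → v∈S }) λ { (here refl) → Pv }

  -- After |S| growth steps the component would have more than |S| elements unless it is closed.
  component-closed : ∀ {v} → Unique S → v ∈ S → EdgeClosed (_∈ component R S v)
  component-closed {v} uS v∈S
    with iterGrow-closed-or-long (length S) (v ∷ []) (λ { (here refl) → v∈S }) uS ([] ∷ [])
  ... | inj₁ closed = closed
  ... | inj₂ long = ⊥-elim (1+n≰n (≤-trans (≤-reflexive (+-comm 1 (length S)))
                                   (≤-trans long (Unique⇒length-mono (component-Unique uS) (component-⊆ v∈S)))))

  component-trans : ∀ {v w} → Unique S → v ∈ S → w ∈ component R S v → component R S w ⊆ component R S v
  component-trans uS v∈S w∈v =
    component-least (_∈ component R S _) (component-closed uS v∈S) (component-⊆ v∈S w∈v) w∈v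

  component-sym : ∀ {v w} → Unique S → v ∈ S → w ∈ component R S v → v ∈ component R S w
  component-sym {v} uS v∈S = component-least (λ u → v ∈ component R S u) closed v∈S component-self
    where
    closed : EdgeClosed (λ u → v ∈ component R S u)
    closed a∈S b∈S v∈a e =
      component-trans uS b∈S (component-closed uS b∈S b∈S a∈S component-self (AhoEdge-sym {R} {S} e)) v∈a

  component-disjoint : ∀ {v v′} → Unique S → v ∈ S → v′ ∈ S → v′ ∉ component R S v →
                       Disjoint (component R S v) (component R S v′)
  component-disjoint uS v∈S v′∈S v′∉v (e∈v , e∈v′) = v′∉v (component-trans uS v∈S e∈v (component-sym uS v′∈S e∈v′))

  outside : List ℕ → List ℕ → List ℕ
  outside C rest = filter (λ u → T? (not (elemB u C))) rest

  ∈-outside⁻ : ∀ {C rest u} → u ∈ outside C rest → u ∈ rest × u ∉ C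
  ∈-outside⁻ {C} {rest} p with ∈-filter⁻ (λ u → T? (not (elemB u C))) {xs = rest} p
  ... | u∈rest , u∉C = u∈rest , elemB≡false⇒∉ (to T-not-≡ u∉C)

  components-cover : ∀ n rest → length rest ≤ n → ∀ {x} → x ∈ rest → ∃[ C ] (C ∈ components n R S rest × x ∈ C)
  components-cover (suc n) (v ∷ rest) (s≤s len) {x} x∈ with DecMembership._∈?_ _≟_ x (component R S v)
  ... | yes x∈v = component R S v , here refl , x∈v
  ... | no x∉v with x∈
  ... | here refl = ⊥-elim (x∉v component-self)
  ... | there x∈rest with components-cover n (outside (component R S v) rest) (≤-trans (length-filter _ rest) len)
                            (∈-filter⁺ _ x∈rest (from T-not-≡ (∉⇒elemB≡false x∉v)))
  ... | C , C∈ , x∈C = C , there C∈ , x∈C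

  components-seed : ∀ n rest {C} → C ∈ components n R S rest → ∃[ v ] (v ∈ rest × C ≡ component R S v)
  components-seed (suc n) (v ∷ rest) (here refl) = v , here refl , refl
  components-seed (suc n) (v ∷ rest) (there p) with components-seed n (outside (component R S v) rest) p
  ... | w , w∈ , refl = w , there (proj₁ (∈-outside⁻ {component R S v} w∈)) , refl

  components-disjoint : ∀ n rest → Unique S → rest ⊆ S → AllPairs Disjoint (components n R S rest)
  components-disjoint zero rest _ _ = []
  components-disjoint (suc n) [] _ _ = []
  components-disjoint (suc n) (v ∷ rest) uS rest⊆S =
    All.tabulate disjoint-from-v ∷
    components-disjoint n (outside (component R S v) rest) uS
      (rest⊆S ∘ there ∘ proj₁ ∘ ∈-outside⁻ {component R S v})
    where
    disjoint-from-v : ∀ {C} → C ∈ components n R S (outside (component R S v) rest) → Disjoint (component R S v) C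
    disjoint-from-v C∈ with components-seed n _ C∈
    ... | w , w∈ , refl with ∈-outside⁻ w∈
    ... | w∈rest , w∉v = component-disjoint uS (rest⊆S (here refl)) (rest⊆S (there w∈rest)) w∉v

componentsOf : List Triple → List ℕ → List (List ℕ)
componentsOf R S = components (length S) R S S

module _ {R : List Triple} {S : List ℕ} where
  open Components R S

  componentsOf-component : ∀ {C} → C ∈ componentsOf R S → ∃[ v ] (v ∈ S × C ≡ component R S v)
  componentsOf-component = components-seed (length S) S

  componentsOf-⊆ : ∀ {C} → C ∈ componentsOf R S → C ⊆ S
  componentsOf-⊆ C∈ with componentsOf-component C∈
  ... | v , v∈S , refl = component-⊆ v∈S

  componentsOf-Unique : ∀ {C} → Unique S → C ∈ componentsOf R S → Unique C
  componentsOf-Unique uS C∈ with componentsOf-component C∈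
  ... | v , v∈S , refl = component-Unique uS

  componentsOf-cover : ∀ {x} → x ∈ S → ∃[ C ] (C ∈ componentsOf R S × x ∈ C)
  componentsOf-cover = components-cover (length S) S ≤-refl

  componentsOf-disjoint : Unique S → AllPairs Disjoint (componentsOf R S)
  componentsOf-disjoint uS = components-disjoint (length S) S uS (λ p → p)

-- Algorithm BUILD

Builds : ℕ → List Triple → List (List ℕ) → List Tree → Set
Builds m R = Pointwise (λ C t → build m R C ≡ just t)

BuildsNode : ℕ → List Triple → List ℕ → Tree → Set
BuildsNode m R S a = ∃[ as ] (a ≡ node as × Builds m R (componentsOf R S) as × 2 ≤ length (componentsOf R S))

buildL-inversion : ∀ m R cs {as} → buildL m R cs ≡ just as → Builds m R cs as
buildL-inversion m R [] refl = []
buildL-inversion m R (C ∷ cs) e with build m R C in e₁ | buildL m R cs in e₂ | e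
... | just t  | just ts | refl = e₁ ∷ buildL-inversion m R cs e₂
... | just t  | nothing | ()
... | nothing | _       | ()

build-inversion : ∀ m R x y rest {a} → build (suc m) R (x ∷ y ∷ rest) ≡ just a → BuildsNode m R (x ∷ y ∷ rest) a
build-inversion m R x y rest {a} = unfolded
  where
  S = x ∷ y ∷ rest
  unfolded : (if length (componentsOf R S) ≤ᵇ 1 then nothing else buildNode (buildL m R (componentsOf R S)))
             ≡ just a →
             BuildsNode m R S a
  unfolded e with length (componentsOf R S) ≤ᵇ 1 in few | buildL m R (componentsOf R S) in built | e
  ... | false | just as | refl = as , refl , buildL-inversion m R _ built , ≤ᵇ1≡false⇒2≤ _ few
  ... | false | nothing | ()
  ... | true  | _       | ()

Sound : List Triple → List ℕ → Tree → Set
Sound R S a = SameSet (leaves a) S × Phylo a × SeparatesOn R S a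

leavesL-components : ∀ {R S as} → Pointwise (λ C t → SameSet (leaves t) C) (componentsOf R S) as →
                     SameSet (leavesL as) S
leavesL-components {R} {S} {as} same x = as⊆S , S⊆as
  where
  as⊆S : x ∈ leavesL as → x ∈ S
  as⊆S x∈as with ∈-leavesL⁻ {as} x∈as
  ... | c , c∈as , x∈c with Pointwise-∈ʳ same c∈as
  ... | C , C∈ , c~C = componentsOf-⊆ C∈ (proj₁ (c~C x) x∈c)
  S⊆as : x ∈ S → x ∈ leavesL as
  S⊆as x∈S with componentsOf-cover {R} x∈S
  ... | C , C∈ , x∈C with Pointwise-∈ˡ same C∈
  ... | c , c∈as , c~C = ∈-leavesL⁺ c∈as (proj₂ (c~C x) x∈C)

Unique-leavesL : ∀ {cs as} → Pointwise (λ C t → Unique (leaves t) × SameSet (leaves t) C) cs as →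
                 AllPairs Disjoint cs → Unique (leavesL as)
Unique-leavesL [] [] = []
Unique-leavesL {C ∷ cs} {a ∷ as} ((ua , a~C) ∷ ps) (C-disjoint ∷ disjoint) =
  Unique.++⁺ ua (Unique-leavesL ps disjoint) λ (x∈a , x∈as) →
    let c , c∈as , x∈c = ∈-leavesL⁻ {as} x∈as
        C′ , C′∈cs , (_ , c~C′) = Pointwise-∈ʳ ps c∈as
    in All.lookup C-disjoint C′∈cs (proj₁ (a~C _) x∈a , proj₁ (c~C′ _) x∈c)

SeparatesOn-node : ∀ {R S as} → Unique S → Pointwise (Sound R) (componentsOf R S) as → SeparatesOn R S (node as)
SeparatesOn-node {R} {S} uS sound {r} r∈R x∈S y∈S z∈S with componentsOf-cover {R} x∈S
... | C , C∈ , x∈C with componentsOf-component C∈ | Pointwise-∈ˡ sound C∈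
... | v , v∈S , refl | c , c∈as , (c~C , _ , c-separates)
  with Components.component-closed R S uS v∈S x∈S y∈S x∈C (AhoEdge-intro r∈R z∈S) | DecMembership._∈?_ _≟_ (tz r) C
... | y∈C | yes z∈C = let K , K∈c , rest = c-separates r∈R x∈C y∈C z∈C in K , there (∈-clustersL⁺ c∈as K∈c) , rest
... | y∈C | no z∉C =
  leaves c , there (∈-clustersL⁺ c∈as (leaves∈clusters c)) ,
  proj₂ (c~C _) x∈C , proj₂ (c~C _) y∈C , z∉C ∘ proj₁ (c~C _)

BuildsNode-sound : ∀ {m R S a} → Unique S → (∀ {C t} → Unique C → build m R C ≡ just t → Sound R C t) →
                   BuildsNode m R S a → Sound R S a
BuildsNode-sound {R = R} {S} uS child-sound (as , refl , builds , two) =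
  leavesL-components (Pointwise.map proj₁ sound) ,
  ((subst (2 ≤_) (Pointwise-length builds) two , branched sound) ,
   Unique-leavesL (Pointwise.map (λ (same , (_ , u) , _) → u , same) sound) (componentsOf-disjoint uS)) ,
  SeparatesOn-node uS sound
  where
  sound : Pointwise (Sound R) (componentsOf R S) as
  sound = Pointwise-map-∈ (λ C∈ → child-sound (componentsOf-Unique uS C∈)) builds
  branched : ∀ {cs ts} → Pointwise (Sound R) cs ts → BranchedL ts
  branched [] = tt
  branched ((_ , (b , _) , _) ∷ ps) = b , branched ps

build-sound : ∀ m R S {a} → All ValidTriple R → Unique S → build m R S ≡ just a → Sound R S a
build-sound (suc m) R (x ∷ []) valid _ refl = SameSet-refl , (tt , [] ∷ []) , singleton-separates
  where
  singleton-separates : SeparatesOn R (x ∷ []) (leaf x)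
  singleton-separates r∈R (here refl) _ (here x≡z) = ⊥-elim (proj₁ (proj₂ (All.lookup valid r∈R)) (sym x≡z))
build-sound (suc m) R (x ∷ y ∷ rest) valid uS e =
  BuildsNode-sound {m} uS (λ {C} → build-sound m R C valid) (build-inversion m R x y rest e)

SeparatesOn-mono : ∀ {R S S′ t} → S′ ⊆ S → SeparatesOn R S t → SeparatesOn R S′ t
SeparatesOn-mono S′⊆S sep r∈R x∈ y∈ z∈ = sep r∈R (S′⊆S x∈) (S′⊆S y∈) (S′⊆S z∈)

SeparatesOn-child : ∀ {R S ts c} → Unique (leavesL ts) → c ∈ ts → S ⊆ leaves c →
                    SeparatesOn R S (node ts) → SeparatesOn R S c
SeparatesOn-child u c∈ts S⊆c sep r∈R x∈S y∈S z∈S =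
  to (Separates⇔Separates-child u c∈ts (S⊆c x∈S) (∈-leavesL⁺ c∈ts (S⊆c z∈S))) (sep r∈R x∈S y∈S z∈S)

module _ {R : List Triple} {S : List ℕ} {ts : List Tree} {c : Tree}
         (u : Unique (leavesL ts)) (S⊆ts : S ⊆ leavesL ts) (sep : SeparatesOn R S (node ts)) (c∈ts : c ∈ ts) where
  open Components R S

  partner-in-child : ∀ {x y z} → z ∈ S → x ∈ leaves c → Separates (node ts) x y z → y ∈ leaves c
  partner-in-child z∈S x∈c s with to (Separates⇔Separates-child u c∈ts x∈c (S⊆ts z∈S)) s
  ... | K , K∈c , _ , y∈K , _ = cluster⊆leaves c K∈c y∈K

  child-EdgeClosed : EdgeClosed (_∈ leaves c)
  child-EdgeClosed a∈S b∈S a∈c e with AhoEdge-elim {R} e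
  ... | r , r∈R , inj₁ (refl , refl) , z∈S = partner-in-child z∈S a∈c (sep r∈R a∈S b∈S z∈S)
  ... | r , r∈R , inj₂ (refl , refl) , z∈S =
    partner-in-child z∈S a∈c (Separates-swap {node ts} (sep r∈R b∈S a∈S z∈S))

  component⊆child : ∀ {v} → v ∈ S → v ∈ leaves c → component R S v ⊆ leaves c
  component⊆child v∈S v∈c = component-least (_∈ leaves c) child-EdgeClosed v∈S v∈c

Disconnected : List Triple → List ℕ → Set
Disconnected R S = ∃[ x ] ∃[ y ] (x ∈ S × y ∈ S × y ∉ component R S x)

separated⇒disconnected : ∀ R t {S} → Unique (leaves t) → S ⊆ leaves t → SeparatesOn R S t →
                         ∀ {x₀ y₀} → x₀ ∈ S → y₀ ∈ S → x₀ ≢ y₀ → Disconnected R S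
separated⇒disconnected R = Tree-ind _ leaf-case node-case
  where
  leaf-case : ∀ w {S} → Unique (w ∷ []) → S ⊆ w ∷ [] → SeparatesOn R S (leaf w) →
              ∀ {x₀ y₀} → x₀ ∈ S → y₀ ∈ S → x₀ ≢ y₀ → Disconnected R S
  leaf-case w _ S⊆w _ x₀∈ y₀∈ x₀≢y₀ with S⊆w x₀∈ | S⊆w y₀∈
  ... | here refl | here refl = ⊥-elim (x₀≢y₀ refl)
  node-case : ∀ ts → (∀ {c} → c ∈ ts → ∀ {S} → Unique (leaves c) → S ⊆ leaves c → SeparatesOn R S c →
                        ∀ {x₀ y₀} → x₀ ∈ S → y₀ ∈ S → x₀ ≢ y₀ → Disconnected R S) →
              ∀ {S} → Unique (leavesL ts) → S ⊆ leavesL ts → SeparatesOn R S (node ts) →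
              ∀ {x₀ y₀} → x₀ ∈ S → y₀ ∈ S → x₀ ≢ y₀ → Disconnected R S
  node-case ts ih {S} u S⊆ts sep {x₀} x₀∈ y₀∈ x₀≢y₀ with ∈-leavesL⁻ {ts} (S⊆ts x₀∈)
  ... | c , c∈ts , x₀∈c with ⊆-or-witness S (leaves c)
  ... | inj₁ S⊆c = ih c∈ts (Unique-child u c∈ts) S⊆c (SeparatesOn-child u c∈ts S⊆c sep) x₀∈ y₀∈ x₀≢y₀
  ... | inj₂ (y , y∈S , y∉c) = x₀ , y , x₀∈ , y∈S , y∉c ∘ component⊆child u S⊆ts sep c∈ts x₀∈ x₀∈c

disconnected⇒two-components : ∀ {R S} → Unique S → Disconnected R S → 2 ≤ length (componentsOf R S)
disconnected⇒two-components {R} {S} uS (x , y , x∈S , y∈S , y∉x)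
  with componentsOf-cover {R} x∈S | componentsOf-cover {R} y∈S
... | C , C∈ , x∈C | D , D∈ , y∈D = at-least-two (componentsOf R S) C∈ D∈ componentsOf-component
  where
  open Components R S
  at-least-two : ∀ cs → C ∈ cs → D ∈ cs → (∀ {E} → E ∈ cs → ∃[ v ] (v ∈ S × E ≡ component R S v)) → 2 ≤ length cs
  at-least-two (_ ∷ _ ∷ _) _ _ _ = s≤s (s≤s z≤n)
  at-least-two (E ∷ []) (here refl) (here refl) seed with seed (here refl)
  ... | v , v∈S , refl = ⊥-elim (y∉x (component-trans uS x∈S (component-sym uS v∈S x∈C) y∈D))

component-proper : ∀ {R S C} → Unique S → 2 ≤ length (componentsOf R S) → C ∈ componentsOf R S →
                   ∃[ e ] (e ∈ S × e ∉ C)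
component-proper {R} {S} uS two C∈ =
  missing (componentsOf R S) two C∈ (componentsOf-disjoint uS) componentsOf-component
  where
  open Components R S
  missing : ∀ cs {C} → 2 ≤ length cs → C ∈ cs → AllPairs Disjoint cs →
            (∀ {E} → E ∈ cs → ∃[ v ] (v ∈ S × E ≡ component R S v)) → ∃[ e ] (e ∈ S × e ∉ C)
  missing (C₁ ∷ C₂ ∷ _) _ (here refl) (C₁-disjoint ∷ _) seed with seed (there (here refl))
  ... | v , v∈S , refl = v , v∈S , λ v∈C₁ → All.lookup C₁-disjoint (here refl) (v∈C₁ , component-self)
  missing (C₁ ∷ _ ∷ _) _ (there C∈) (C₁-disjoint ∷ _) seed with seed (here refl)
  ... | v , v∈S , refl = v , v∈S , λ v∈C → All.lookup C₁-disjoint C∈ (component-self , v∈C)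
  missing (_ ∷ []) (s≤s ()) _ _ _

buildL-succeeds : ∀ m R cs → (∀ {C} → C ∈ cs → ∃[ a ] (build m R C ≡ just a)) → ∃[ as ] (buildL m R cs ≡ just as)
buildL-succeeds m R [] _ = [] , refl
buildL-succeeds m R (C ∷ cs) builds with builds (here refl) | buildL-succeeds m R cs (builds ∘ there)
... | a , e | as , es rewrite e | es = a ∷ as , refl

build-node : ∀ m R x y rest {as} → 2 ≤ length (componentsOf R (x ∷ y ∷ rest)) →
             buildL m R (componentsOf R (x ∷ y ∷ rest)) ≡ just as → build (suc m) R (x ∷ y ∷ rest) ≡ just (node as)
build-node m R x y rest {as} two built = unfolded
  where
  S = x ∷ y ∷ rest
  unfolded : (if length (componentsOf R S) ≤ᵇ 1 then nothing else buildNode (buildL m R (componentsOf R S)))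
             ≡ just (node as)
  unfolded rewrite 2≤⇒≤ᵇ1≡false two | built = refl

build-succeeds : ∀ m R S w → Unique (leaves w) → S ⊆ leaves w → SeparatesOn R S w → Unique S →
                 ∀ {x₀} → x₀ ∈ S → length S < m → ∃[ a ] (build m R S ≡ just a)
build-succeeds (suc m) R (x ∷ []) _ _ _ _ _ _ _ = leaf x , refl
build-succeeds (suc m) R S@(x ∷ y ∷ rest) w uw S⊆w sep uS@(x∉ ∷ _) _ (s≤s len) =
  let as , built = buildL-succeeds m R (componentsOf R S) builds-component
  in node as , build-node m R x y rest two built
  where
  two : 2 ≤ length (componentsOf R S)
  two = disconnected⇒two-components uS
          (separated⇒disconnected R w uw S⊆w sep (here refl) (there (here refl)) (All.head x∉))
  builds-component : ∀ {C} → C ∈ componentsOf R S → ∃[ a ] (build m R C ≡ just a)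
  builds-component C∈ with componentsOf-component C∈ | component-proper uS two C∈
  ... | v , _ , refl | e , e∈S , e∉C =
    build-succeeds m R _ w uw (S⊆w ∘ componentsOf-⊆ C∈) (SeparatesOn-mono (componentsOf-⊆ C∈) sep)
      (componentsOf-Unique uS C∈) (Components.component-self R S)
      (≤-trans (Unique⇒length-strictMono (componentsOf-Unique uS C∈) (componentsOf-⊆ C∈) e∈S e∉C) len)

BuildsNode-⊑ : ∀ {m R S us a} → All ValidTriple R → Unique S → BuildsNode m R S a → Sound R S a →
               (∀ {C c d} → Unique C → build m R C ≡ just c → SameSet C (leaves d) → Phylo d →
                  SeparatesOn R C d → clusters d ⊑ clusters c → clusters c ⊑ clusters d) →
               SameSet S (leavesL us) → Phylo (node us) → SeparatesOn R S (node us) →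
               clusters (node us) ⊑ clusters a → clusters a ⊑ clusters (node us)
BuildsNode-⊑ {m} {R} {S} {us} valid uS (as , refl , builds , _) (a~S , (_ , uas) , _) ih
             S~u pu@((_ , bus) , uus) sep u⊑a = λ
  { (here refl) → leavesL us , here refl , SameSet-trans a~S S~u
  ; (there K∈as) → child-cluster K∈as }
  where
  open Components R S
  us⊑as : clustersL us ⊑ clustersL as
  us⊑as = ⊑-children {us} {as} pu u⊑a
  child-cluster : ∀ {K} → K ∈ clustersL as → ∃[ K′ ] (K′ ∈ clusters (node us) × SameSet K K′)
  child-cluster K∈as with ∈-clustersL⁻ {as} K∈as
  ... | c , c∈as , K∈c with Pointwise-∈ʳ builds c∈as
  ... | C , C∈ , built with componentsOf-component C∈
  ... | v , v∈S , refl with ∈-leavesL⁻ {us} (proj₁ (S~u v) v∈S)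
  ... | d , d∈us , v∈d =
    let K′ , K′∈d , K~K′ = ih (componentsOf-Unique uS C∈) built C~d (Phylo-child (bus , uus) d∈us) sep-d d⊑c K∈c
    in K′ , there (∈-clustersL⁺ d∈us K′∈d) , K~K′
    where
    c~C : SameSet (leaves c) (component R S v)
    c~C = proj₁ (build-sound m R _ valid (componentsOf-Unique uS C∈) built)
    v∈c = proj₂ (c~C v) component-self
    C~d : SameSet (component R S v) (leaves d)
    C~d z = component⊆child uus (proj₁ (S~u _)) sep d∈us v∈S v∈d ,
            proj₁ (c~C z) ∘ child⊆child {as} {us} uas us⊑as d∈us c∈as v∈d v∈c
    sep-d : SeparatesOn R (component R S v) d
    sep-d = SeparatesOn-child uus d∈us (proj₁ (C~d _)) (SeparatesOn-mono {t = node us} (component-⊆ v∈S) sep)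
    d⊑c : clusters d ⊑ clusters c
    d⊑c = ⊑-child {as} {us} uas bus us⊑as d∈us c∈as v∈d v∈c

build-⊑ : ∀ m R S u {a} → All ValidTriple R → Unique S → build m R S ≡ just a →
          SameSet S (leaves u) → Phylo u → SeparatesOn R S u → clusters u ⊑ clusters a → clusters a ⊑ clusters u
build-⊑ (suc m) R (x ∷ []) u valid _ refl S~u _ _ _ (here refl) = leaves u , leaves∈clusters u , S~u
build-⊑ (suc m) R (x ∷ y ∷ rest) (leaf w) valid (x∉ ∷ _) _ S~u _ _ _ _
  with proj₁ (S~u x) (here refl) | proj₁ (S~u y) (there (here refl))
... | here refl | here refl = ⊥-elim (All.head x∉ refl)
build-⊑ (suc m) R (x ∷ y ∷ rest) (node us) valid uS e =
  BuildsNode-⊑ {m} valid uS (build-inversion m R x y rest e) (build-sound (suc m) R (x ∷ y ∷ rest) valid uS e)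
    (λ {C} {c} {d} → build-⊑ m R C d valid)

triple-leaves : Triple → List ℕ
triple-leaves r = tx r ∷ ty r ∷ tz r ∷ []

∈-LR⁺ : ∀ {R r x} → r ∈ R → x ∈ triple-leaves r → x ∈ LR R
∈-LR⁺ r∈R x∈r = ∈-deduplicate⁺ _≟_ (∈-concatMap⁺ triple-leaves (lose r∈R x∈r))

∈-LR⁻ : ∀ {R x} → x ∈ LR R → ∃[ r ] (r ∈ R × x ∈ triple-leaves r)
∈-LR⁻ {R} x∈ = find (∈-concatMap⁻ triple-leaves {xs = R} (∈-deduplicate⁻ _≟_ _ x∈))

Unique-LR : ∀ R → Unique (LR R)
Unique-LR R = deduplicate-! _≟_ _

Displays⇒SeparatesOn : ∀ {R S} t → Unique (leaves t) → All (Displays t) R → SeparatesOn R S t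
Displays⇒SeparatesOn t ut displays r∈R _ _ _ =
  proj₂ (proj₂ (proj₂ (to (displaysB⇔Separates t ut) (All.lookup displays r∈R))))

Displays⇒LR⊆leaves : ∀ {R} t → Unique (leaves t) → All (Displays t) R → LR R ⊆ leaves t
Displays⇒LR⊆leaves t ut displays x∈ with ∈-LR⁻ x∈
... | r , r∈R , x∈r with to (displaysB⇔Separates t ut) (All.lookup displays r∈R) | x∈r
... | x∈t , _ , _ , _ | here refl = x∈t
... | _ , y∈t , _ , _ | there (here refl) = y∈t
... | _ , _ , z∈t , _ | there (there (here refl)) = z∈t

SeparatesOn⇒Displays : ∀ {R} t → Unique (leaves t) → LR R ⊆ leaves t → SeparatesOn R (LR R) t → All (Displays t) R
SeparatesOn⇒Displays t ut LR⊆t sep = All.tabulate λ r∈R →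
  let x∈ = ∈-LR⁺ r∈R (here refl) ; y∈ = ∈-LR⁺ r∈R (there (here refl)) ; z∈ = ∈-LR⁺ r∈R (there (there (here refl)))
  in from (displaysB⇔Separates t ut) (LR⊆t x∈ , LR⊆t y∈ , LR⊆t z∈ , sep r∈R x∈ y∈ z∈)

Identifies⇒OnLeaves : ∀ {R t} → Consistent R → Identifies R t → OnLeaves t (LR R)
Identifies⇒OnLeaves {t = t} (s , ps , s~L , s-displays) ((_ , ut) , t-displays , refines) x =
  proj₁ (s~L x) ∘ ⊑⇒leaves⊆ t s (Refines⇒⊑ (refines s ps s~L s-displays)) , Displays⇒LR⊆leaves t ut t-displays

aho-≅-identified : ∀ {R t} → All ValidTriple R → Identifies R t → OnLeaves t (LR R) →
                   ∃[ a ] (aho R ≡ just a × Phylo a × clusters t ⊑ clusters a × clusters a ⊑ clusters t)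
aho-≅-identified {R} {t} valid (pt@(bt , ut) , t-displays , refines) t~L =
  a , built , pa , t⊑a , build-⊑ m R L t valid (Unique-LR R) built (SameSet-sym t~L) pt t-separates t⊑a
  where
  L = LR R
  m = suc (length L)
  t-separates : SeparatesOn R L t
  t-separates = Displays⇒SeparatesOn t ut t-displays
  aho-succeeds : ∃[ a ] (build m R L ≡ just a)
  aho-succeeds = build-succeeds m R L t ut (proj₂ (t~L _)) t-separates (Unique-LR R)
                   (proj₁ (t~L _) (proj₂ (leaves-nonempty t bt))) ≤-refl
  a = proj₁ aho-succeeds
  built = proj₂ aho-succeeds
  a-sound : Sound R L a
  a-sound = build-sound m R L valid (Unique-LR R) built
  pa = proj₁ (proj₂ a-sound)
  t⊑a : clusters t ⊑ clusters a
  t⊑a = Refines⇒⊑ (refines a pa (proj₁ a-sound)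
          (SeparatesOn⇒Displays a (proj₂ pa) (proj₂ (proj₁ a-sound _)) (proj₂ (proj₂ a-sound))))

lemma8 : (R : List Triple) → All ValidTriple R → Consistent R →
         (t : Tree) → Identifies R t →
         (t₁ : Tree) → Phylo t₁ → OnLeaves t₁ (LR R) → All (Displays t₁) R →
         (∀ s → Phylo s → OnLeaves s (LR R) → All (Displays s) R → size t₁ ≤ size s) →
         (t₂ : Tree) → Phylo t₂ → OnLeaves t₂ (LR R) → All (Displays t₂) R →
         (∀ s → Phylo s → OnLeaves s (LR R) → All (Displays s) R → tripleCount t₂ ≤ tripleCount s) →
         ∃[ a ] ((aho R ≡ just a) × (t ≅ a) × (a ≅ t₁) × (t₁ ≅ t₂))
lemma8 R valid consistent t identifies@(pt , t-displays , refines)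
       t₁ p₁ t₁~L t₁-displays t₁-min t₂ p₂ t₂~L t₂-displays t₂-min =
  let t~L = Identifies⇒OnLeaves consistent identifies
      a , built , pa , t⊑a , a⊑t = aho-≅-identified valid identifies t~L
      t⊑t₁ = Refines⇒⊑ (refines t₁ p₁ t₁~L t₁-displays)
      t₁⊑t = ⊑-antisym-by-size t t₁ pt t⊑t₁ (t₁-min t pt t~L t-displays)
      t⊑t₂ = Refines⇒⊑ (refines t₂ p₂ t₂~L t₂-displays)
      t₂⊑t = ⊑-antisym-by-tripleCount t t₂ pt p₂ (SameSet-trans t~L (SameSet-sym t₂~L)) t⊑t₂
               (t₂-min t pt t~L t-displays)
  in a , built ,
     ⊑-antisym⇒≅ t a pt pa t⊑a a⊑t ,
     ⊑-antisym⇒≅ a t₁ pa p₁ (⊑-trans a⊑t t⊑t₁) (⊑-trans t₁⊑t t⊑a) ,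
     ⊑-antisym⇒≅ t₁ t₂ p₁ p₂ (⊑-trans t₁⊑t t⊑t₂) (⊑-trans t₂⊑t t⊑t₁)
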